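{- For every integer $n\ge 0$: (a) $\displaystyle\sum_{k=0}^{\lfloor n/2\rfloor}q(n-2k)\,\omega(k)=\delta_t(n)$; (b) $\displaystyle\sum_{k=0}^{\lfloor n/2\rfloor}p(k)\,\delta_t(n-2k)=q(n)$; (c) $\displaystyle\sum_{k=0}^{n}(-1)^k qq(k)\,\delta_t(n-k)=\begin{cases}\omega(n/2)&\text{if } n \text{ is even},\\ 0&\text{otherwise.}\end{cases}$
   Context: $p(n)$ is the number of partitions of $n$, $q(n)$ the number of partitions of $n$ into distinct parts, and $qq(n)$ the number of partitions of $n$ into distinct odd parts (all equal to $1$ at $n=0$). $\delta_t(n)=1$ if $n=\frac{m(m+1)}{2}$ for some integer $m\ge 0$, and $0$ otherwise. For integers $m$, $\omega(m)=1$ if $m=0$; $\omega(m)=(-1)^k$ if $m=\frac{3k^2\pm k}{2}$ for some positive integer $k$; $\omega(m)=0$ otherwise. -}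

module Defs where

open import Data.Nat using (ℕ; zero; suc; _+_; _*_; _∸_; _≤ᵇ_; _<ᵇ_; _≡ᵇ_; _/_; _%_)
open import Data.Bool using (Bool; true; false; _∧_; _∨_; if_then_else_; not)
open import Data.List using (List; []; _∷_; length; map; concatMap; filter; upTo; sum; foldr; applyUpTo)
open import Data.Integer using (ℤ; +_; -_)
open import Relation.Binary.PropositionalEquality using (_≡_)

-- A partition is represented as a weakly decreasing list of positive parts.
-- partsBounded f m n : all weakly decreasing lists of positive integers,
-- each part ≤ m, summing to n.  (f is fuel ≥ n.)
partsBounded : ℕ → ℕ → ℕ → List (List ℕ)
partsBounded _ _ zero = [] ∷ []
partsBounded zero _ (suc n) = []
partsBounded (suc f) m (suc n) =
  concatMap (λ j → let a = suc j in
                    if (a ≤ᵇ m) then map (a ∷_) (partsBounded f a (suc n ∸ a)) else [])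
            (upTo (suc n))

partitions : ℕ → List (List ℕ)
partitions n = partsBounded n n n

strictlyDecreasing : List ℕ → Bool
strictlyDecreasing [] = true
strictlyDecreasing (a ∷ []) = true
strictlyDecreasing (a ∷ b ∷ xs) = (b <ᵇ a) ∧ strictlyDecreasing (b ∷ xs)

isOdd : ℕ → Bool
isOdd a = a % 2 ≡ᵇ 1

allOdd : List ℕ → Bool
allOdd [] = true
allOdd (a ∷ xs) = isOdd a ∧ allOdd xs

countWhere : (List ℕ → Bool) → List (List ℕ) → ℕ
countWhere P [] = 0
countWhere P (x ∷ xs) = (if P x then 1 else 0) + countWhere P xs

p : ℕ → ℕ
p n = length (partitions n)

q : ℕ → ℕ
q n = countWhere strictlyDecreasing (partitions n)

qq : ℕ → ℕ
qq n = countWhere (λ xs → strictlyDecreasing xs ∧ allOdd xs) (partitions n)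

-- δ_t(n) = 1 if n = m(m+1)/2 for some m ≥ 0 (necessarily m ≤ n), else 0.
anyUpTo : ℕ → (ℕ → Bool) → Bool
anyUpTo zero P = P zero
anyUpTo (suc n) P = P (suc n) ∨ anyUpTo n P

isTriangular : ℕ → Bool
isTriangular n = anyUpTo n (λ m → (m * (m + 1)) / 2 ≡ᵇ n)

δt : ℕ → ℤ
δt n = if isTriangular n then + 1 else + 0

-- ω(m) for m ≥ 0: 1 if m = 0; (-1)^k if m = (3k²±k)/2 for some k ≥ 1
-- (such k is unique and satisfies k ≤ m); 0 otherwise.
sgn : ℕ → ℤ
sgn k = if isOdd k then - (+ 1) else + 1

pentK : ℕ → ℕ → Bool
pentK m k = ((3 * k * k + k) / 2 ≡ᵇ m) ∨ ((3 * k * k ∸ k) / 2 ≡ᵇ m)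

findPent : ℕ → ℕ → ℤ
findPent m zero = + 0
findPent m (suc k) = if pentK m (suc k) then sgn (suc k) else findPent m k

ω : ℕ → ℤ
ω zero = + 1
ω (suc m) = findPent (suc m) (suc m)

sumTo : ℕ → (ℕ → ℤ) → ℤ
sumTo zero f = f zero
sumTo (suc N) f = sumTo N f Data.Integer.+ f (suc N)

negOnePow : ℕ → ℤ
negOnePow = sgn

{-# OPTIONS --safe #-}
-- With E = ∏ (1 − x^j) = ∑ ω(k) x^k (Euler's pentagonal number theorem), ∑ q(n) x^n = ∏ (1 + x^j),
-- ∑ p(n) x^n = 1/E, ∑ (−1)^n qq(n) x^n = ∏ (1 − x^{2j−1}) and T = ∑ δ_t(n) x^n = ∏ (1 − x^{2j})(1 + x^j)
-- (Gauss), the three identities say Q(x) E(x²) = T(x), T(x)/E(x²) = Q(x) and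
-- ∏ (1 − x^{2j−1}) · T(x) = E(x²); the last because ∏ (1 − x^{2j−1}) (1 − x^{2j}) = E(x) and
-- E(x) Q(x) = E(x²).
--
-- Series are functions ℕ → ℤ, and multiplication by finite products acts on them as commuting
-- operators; every identity is proved with finite products and read off in degrees below the
-- first omitted factor. Euler's theorem comes from Shanks' finite identity, Gauss's from Cauchy's
-- finite form of the triple product, and the generating functions from removing the largest part.
module Submission where

open import Defs
open import Data.Bool using (Bool; true; false; T; _∧_; _∨_; if_then_else_)
import Data.Bool.Properties as Boolₚ
open import Data.Empty using (⊥-elim)
open import Data.Integer using (ℤ; +_; -_; _+_; _*_; _-_)
import Data.Integer.Properties as ℤₚ
open import Data.Integer.Tactic.RingSolver using (solve-∀)
open import Data.List using (List; []; _∷_; [_]; _++_; map; foldr; concatMap; upTo; applyUpTo; length)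
import Data.List.Properties as Listₚ
open import Data.List.Relation.Unary.All using (All; []; _∷_)
import Data.List.Relation.Unary.All.Properties as Allₚ
import Data.Nat
open import Data.Nat as ℕ using (ℕ; zero; suc; _≤_; _<_; z≤n; s≤s; _∸_; _/_; _≡ᵇ_; _≤ᵇ_; _<ᵇ_)
open import Data.Nat.DivMod using (m/n≤m; m/n*n≤m; m*n/n≡m; /-monoˡ-≤; [m+n]%n≡m%n; m%n<n; m%n≡m∸m/n*n)
import Data.Nat.Properties as ℕₚ
import Data.Nat.Tactic.RingSolver as ℕ-Solver
open import Data.Product using (_×_; _,_)
open import Data.Sum using (inj₁; inj₂)
open import Function using (_∘_)
open import Relation.Binary.PropositionalEquality hiding ([_])

open ≡-Reasoning

Series : Set
Series = ℕ → ℤ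

Op : Set
Op = Series → Series

infix 4 _≗[≤_]_
_≗[≤_]_ : Series → ℕ → Series → Set
f ≗[≤ m ] g = ∀ k → k ≤ m → f k ≡ g k

0ₛ δ₀ : Series
0ₛ _ = + 0
δ₀ zero = + 1
δ₀ (suc _) = + 0

infixl 6 _+ₛ_
_+ₛ_ : Series → Series → Series
(f +ₛ g) n = f n + g n

infixl 6 _-ₛ_
_-ₛ_ : Series → Series → Series
(f -ₛ g) n = f n - g n

infixr 7 _·ₛ_
_·ₛ_ : ℤ → Series → Series
(c ·ₛ f) n = c * f n

infixr 8 x^_·_
x^_·_ : ℕ → Op
(x^ zero · f) n = f n
(x^ suc e · f) zero = + 0
(x^ suc e · f) (suc n) = (x^ e · f) n

∑ : ℕ → (ℕ → ℤ) → ℤ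
∑ zero F = + 0
∑ (suc n) F = F 0 + ∑ n (F ∘ suc)

∑-cong-< : ∀ n {F G : ℕ → ℤ} → (∀ k → k < n → F k ≡ G k) → ∑ n F ≡ ∑ n G
∑-cong-< zero eq = refl
∑-cong-< (suc n) eq = cong₂ _+_ (eq 0 (s≤s z≤n)) (∑-cong-< n (λ k k<n → eq (suc k) (s≤s k<n)))

∑-cong : ∀ n {F G : ℕ → ℤ} → F ≗ G → ∑ n F ≡ ∑ n G
∑-cong n eq = ∑-cong-< n (λ k _ → eq k)

∑-zero-< : ∀ n {F : ℕ → ℤ} → (∀ k → k < n → F k ≡ + 0) → ∑ n F ≡ + 0
∑-zero-< zero eq = refl
∑-zero-< (suc n) eq = cong₂ _+_ (eq 0 (s≤s z≤n)) (∑-zero-< n (λ k k<n → eq (suc k) (s≤s k<n)))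

∑-zero : ∀ n {F : ℕ → ℤ} → (∀ k → F k ≡ + 0) → ∑ n F ≡ + 0
∑-zero n eq = ∑-zero-< n (λ k _ → eq k)

∑-distrib-+ : ∀ n (F G : ℕ → ℤ) → ∑ n (λ k → F k + G k) ≡ ∑ n F + ∑ n G
∑-distrib-+ zero F G = refl
∑-distrib-+ (suc n) F G = begin
  F 0 + G 0 + ∑ n (λ k → F (suc k) + G (suc k))  ≡⟨ cong (_+_ (F 0 + G 0)) (∑-distrib-+ n (F ∘ suc) (G ∘ suc)) ⟩
  F 0 + G 0 + (∑ n (F ∘ suc) + ∑ n (G ∘ suc))     ≡⟨ interchange (F 0) (G 0) _ _ ⟩
  F 0 + ∑ n (F ∘ suc) + (G 0 + ∑ n (G ∘ suc))     ∎
  where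
  interchange : ∀ a b c d → a + b + (c + d) ≡ a + c + (b + d)
  interchange = solve-∀

*-distribˡ-∑ : ∀ n c (F : ℕ → ℤ) → c * ∑ n F ≡ ∑ n (λ k → c * F k)
*-distribˡ-∑ zero c F = ℤₚ.*-zeroʳ c
*-distribˡ-∑ (suc n) c F =
  trans (ℤₚ.*-distribˡ-+ c (F 0) _) (cong (_+_ (c * F 0)) (*-distribˡ-∑ n c (F ∘ suc)))

∑-neg : ∀ n (F : ℕ → ℤ) → ∑ n (λ k → - F k) ≡ - ∑ n F
∑-neg zero F = refl
∑-neg (suc n) F = trans (cong (_+_ (- F 0)) (∑-neg n (F ∘ suc))) (sym (ℤₚ.neg-distrib-+ (F 0) _))

∑-last : ∀ n (F : ℕ → ℤ) → ∑ (suc n) F ≡ ∑ n F + F n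
∑-last zero F = trans (ℤₚ.+-identityʳ (F 0)) (sym (ℤₚ.+-identityˡ (F 0)))
∑-last (suc n) F = trans (cong (_+_ (F 0)) (∑-last n (F ∘ suc))) (sym (ℤₚ.+-assoc (F 0) _ _))

∑-split : ∀ a b (F : ℕ → ℤ) → ∑ (a ℕ.+ b) F ≡ ∑ a F + ∑ b (λ k → F (a ℕ.+ k))
∑-split zero b F = sym (ℤₚ.+-identityˡ _)
∑-split (suc a) b F = trans (cong (_+_ (F 0)) (∑-split a b (F ∘ suc))) (sym (ℤₚ.+-assoc (F 0) _ _))

∑-reverse : ∀ n (F : ℕ → ℤ) → ∑ n (λ k → F (n ∸ suc k)) ≡ ∑ n F
∑-reverse zero F = refl
∑-reverse (suc n) F = begin
  F n + ∑ n (λ k → F (n ∸ suc k))  ≡⟨ cong (_+_ (F n)) (∑-reverse n F) ⟩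
  F n + ∑ n F                      ≡⟨ ℤₚ.+-comm (F n) _ ⟩
  ∑ n F + F n                      ≡⟨ ∑-last n F ⟨
  ∑ (suc n) F                      ∎

∑-extend : ∀ {n N} (F : ℕ → ℤ) → n ≤ N → (∀ k → n ≤ k → F k ≡ + 0) → ∑ N F ≡ ∑ n F
∑-extend {n} {N} F n≤N vanish = begin
  ∑ N F                                    ≡⟨ cong (λ b → ∑ b F) (ℕₚ.m+[n∸m]≡n n≤N) ⟨
  ∑ (n ℕ.+ (N ∸ n)) F                      ≡⟨ ∑-split n (N ∸ n) F ⟩
  ∑ n F + ∑ (N ∸ n) (λ k → F (n ℕ.+ k))    ≡⟨ cong (_+_ (∑ n F)) (∑-zero (N ∸ n) (λ k → vanish (n ℕ.+ k) (ℕₚ.m≤m+n n k))) ⟩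
  ∑ n F + + 0                              ≡⟨ ℤₚ.+-identityʳ _ ⟩
  ∑ n F                                    ∎

x^-below : ∀ e f {m} → m < e → (x^ e · f) m ≡ + 0
x^-below (suc e) f {zero} _ = refl
x^-below (suc e) f {suc m} (s≤s m<e) = x^-below e f m<e

*-x^-below : ∀ a e f {m} → m < e → a * (x^ e · f) m ≡ + 0
*-x^-below a e f m<e = trans (cong (a *_) (x^-below e f m<e)) (ℤₚ.*-zeroʳ a)

x^-above : ∀ e f {m} → e ≤ m → (x^ e · f) m ≡ f (m ∸ e)
x^-above zero f _ = refl
x^-above (suc e) f {suc m} (s≤s e≤m) = x^-above e f e≤m

x^-+ : ∀ a b f → x^ a · x^ b · f ≗ x^ (a ℕ.+ b) · f
x^-+ zero b f n = refl
x^-+ (suc a) b f zero = refl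
x^-+ (suc a) b f (suc n) = x^-+ a b f n

x^-comm : ∀ a b f → x^ a · x^ b · f ≗ x^ b · x^ a · f
x^-comm a b f n = begin
  (x^ a · x^ b · f) n    ≡⟨ x^-+ a b f n ⟩
  (x^ (a ℕ.+ b) · f) n   ≡⟨ cong (λ e → (x^ e · f) n) (ℕₚ.+-comm a b) ⟩
  (x^ (b ℕ.+ a) · f) n   ≡⟨ x^-+ b a f n ⟨
  (x^ b · x^ a · f) n    ∎

x^-causal : ∀ e {f g} m → f ≗[≤ m ] g → (x^ e · f) m ≡ (x^ e · g) m
x^-causal zero m eq = eq m ℕₚ.≤-refl
x^-causal (suc e) zero eq = refl
x^-causal (suc e) (suc m) eq = x^-causal e m (λ k k≤m → eq k (ℕₚ.m≤n⇒m≤1+n k≤m))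

x^-cong : ∀ e {f g} → f ≗ g → x^ e · f ≗ x^ e · g
x^-cong e eq m = x^-causal e m (λ k _ → eq k)

x^-plus : ∀ e f g → x^ e · (f +ₛ g) ≗ x^ e · f +ₛ x^ e · g
x^-plus zero f g n = refl
x^-plus (suc e) f g zero = refl
x^-plus (suc e) f g (suc n) = x^-plus e f g n

x^-minus : ∀ e f g → x^ e · (f -ₛ g) ≗ x^ e · f -ₛ x^ e · g
x^-minus zero f g n = refl
x^-minus (suc e) f g zero = refl
x^-minus (suc e) f g (suc n) = x^-minus e f g n

x^-scale : ∀ e c f → x^ e · (c ·ₛ f) ≗ c ·ₛ x^ e · f
x^-scale zero c f n = refl
x^-scale (suc e) c f zero = sym (ℤₚ.*-zeroʳ c)
x^-scale (suc e) c f (suc n) = x^-scale e c f n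

x^-zero : ∀ e → x^ e · 0ₛ ≗ 0ₛ
x^-zero zero n = refl
x^-zero (suc e) zero = refl
x^-zero (suc e) (suc n) = x^-zero e n

≡ᵇ-sound : ∀ {m n} → (m ≡ᵇ n) ≡ true → m ≡ n
≡ᵇ-sound {m} {n} eq = ℕₚ.≡ᵇ⇒≡ m n (subst T (sym eq) _)

x^-δ₀ : ∀ e m → (x^ e · δ₀) m ≡ (if e ≡ᵇ m then + 1 else + 0)
x^-δ₀ zero zero = refl
x^-δ₀ zero (suc m) = refl
x^-δ₀ (suc e) zero = refl
x^-δ₀ (suc e) (suc m) = x^-δ₀ e m

x^-δ₀-off : ∀ e {m} → e ≢ m → (x^ e · δ₀) m ≡ + 0
x^-δ₀-off e {m} e≢m = trans (x^-δ₀ e m) (cong (λ b → if b then + 1 else + 0) (≡ᵇ-false e≢m))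
  where
  ≡ᵇ-false : ∀ {a b} → a ≢ b → (a ≡ᵇ b) ≡ false
  ≡ᵇ-false {a} {b} a≢b with a ≡ᵇ b in eq
  ... | true = ⊥-elim (a≢b (≡ᵇ-sound eq))
  ... | false = refl

∑-x^-δ₀ : ∀ n (a : ℕ → ℤ) {j} → j < n → ∑ n (λ k → a k * (x^ k · δ₀) j) ≡ a j
∑-x^-δ₀ (suc n) a {zero} _ = begin
  a 0 * + 1 + ∑ n (λ k → a (suc k) * + 0)   ≡⟨ cong₂ _+_ (ℤₚ.*-identityʳ (a 0)) (∑-zero n (λ k → ℤₚ.*-zeroʳ (a (suc k)))) ⟩
  a 0 + + 0                                 ≡⟨ ℤₚ.+-identityʳ (a 0) ⟩
  a 0                                       ∎
∑-x^-δ₀ (suc n) a {suc j} (s≤s j<n) = begin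
  a 0 * + 0 + ∑ n (λ k → a (suc k) * (x^ k · δ₀) j)   ≡⟨ cong₂ _+_ (ℤₚ.*-zeroʳ (a 0)) (∑-x^-δ₀ n (a ∘ suc) j<n) ⟩
  + 0 + a (suc j)                                     ≡⟨ ℤₚ.+-identityˡ _ ⟩
  a (suc j)                                           ∎

-- Multiplication by a power series, axiomatised as a causal linear operator commuting with x.
-- Every multiplier X is multiplication by X δ₀, so any two commute; this replaces a ring of power series.
record IsMultiplier (X : Op) : Set where
  field
    causal  : ∀ {f g} m → f ≗[≤ m ] g → X f m ≡ X g m
    +ₛ-homo : ∀ f g → X (f +ₛ g) ≗ X f +ₛ X g
    ·ₛ-homo : ∀ c f → X (c ·ₛ f) ≗ c ·ₛ X f
    x^-homo : ∀ e f → X (x^ e · f) ≗ x^ e · X f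

  cong-≗ : ∀ {f g} → f ≗ g → X f ≗ X g
  cong-≗ eq m = causal m (λ k _ → eq k)

  0ₛ-homo : X 0ₛ ≗ 0ₛ
  0ₛ-homo m = trans (cong-≗ (λ n → sym (ℤₚ.*-zeroˡ (0ₛ n))) m) (·ₛ-homo (+ 0) 0ₛ m)

  ∑-homo : ∀ n (G : ℕ → Series) → X (λ m → ∑ n (λ k → G k m)) ≗ (λ m → ∑ n (λ k → X (G k) m))
  ∑-homo zero G m = 0ₛ-homo m
  ∑-homo (suc n) G m =
    trans (+ₛ-homo (G 0) _ m) (cong (_+_ (X (G 0) m)) (∑-homo n (G ∘ suc) m))

open IsMultiplier public

infixr 7 _[x^_]·_
_[x^_]·_ : Series → ℕ → Op
(c [x^ d ]· f) n = ∑ (suc n) (λ k → c k * (x^ (d ℕ.* k) · f) n)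

multiplier-expansion : ∀ {X} → IsMultiplier X → ∀ f → X f ≗ f [x^ 1 ]· X δ₀
multiplier-expansion {X} isX f m = begin
  X f m                                                    ≡⟨ causal isX m decompose ⟩
  X (λ j → ∑ (suc m) (λ k → (f k ·ₛ x^ k · δ₀) j)) m       ≡⟨ ∑-homo isX (suc m) (λ k → f k ·ₛ x^ k · δ₀) m ⟩
  ∑ (suc m) (λ k → X (f k ·ₛ x^ k · δ₀) m)                 ≡⟨ ∑-cong (suc m) term ⟩
  (f [x^ 1 ]· X δ₀) m                                      ∎
  where
  decompose : f ≗[≤ m ] (λ j → ∑ (suc m) (λ k → (f k ·ₛ x^ k · δ₀) j))
  decompose j j≤m = sym (∑-x^-δ₀ (suc m) f (s≤s j≤m))
  term : ∀ k → X (f k ·ₛ x^ k · δ₀) m ≡ f k * (x^ (1 ℕ.* k) · X δ₀) m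
  term k = begin
    X (f k ·ₛ x^ k · δ₀) m      ≡⟨ ·ₛ-homo isX (f k) _ m ⟩
    f k * X (x^ k · δ₀) m       ≡⟨ cong (f k *_) (x^-homo isX k δ₀ m) ⟩
    f k * (x^ k · X δ₀) m       ≡⟨ cong (λ e → f k * (x^ e · X δ₀) m) (ℕₚ.*-identityˡ k) ⟨
    f k * (x^ (1 ℕ.* k) · X δ₀) m ∎

[x^1]-coefficient : ∀ a b n → (a [x^ 1 ]· b) n ≡ ∑ (suc n) (λ k → a k * b (n ∸ k))
[x^1]-coefficient a b n = ∑-cong-< (suc n) (λ k k<sn → cong (a k *_) (begin
  (x^ (1 ℕ.* k) · b) n   ≡⟨ cong (λ e → (x^ e · b) n) (ℕₚ.*-identityˡ k) ⟩
  (x^ k · b) n           ≡⟨ x^-above k b (ℕ.s≤s⁻¹ k<sn) ⟩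
  b (n ∸ k)              ∎))

[x^1]-comm : ∀ a b → a [x^ 1 ]· b ≗ b [x^ 1 ]· a
[x^1]-comm a b n = begin
  (a [x^ 1 ]· b) n                                ≡⟨ [x^1]-coefficient a b n ⟩
  ∑ (suc n) (λ k → a k * b (n ∸ k))               ≡⟨ ∑-reverse (suc n) (λ k → a k * b (n ∸ k)) ⟨
  ∑ (suc n) (λ k → a (n ∸ k) * b (n ∸ (n ∸ k)))   ≡⟨ ∑-cong-< (suc n) swap ⟩
  ∑ (suc n) (λ k → b k * a (n ∸ k))               ≡⟨ [x^1]-coefficient b a n ⟨
  (b [x^ 1 ]· a) n                                ∎
  where
  swap : ∀ k → k < suc n → a (n ∸ k) * b (n ∸ (n ∸ k)) ≡ b k * a (n ∸ k)
  swap k k<sn = trans (cong (λ i → a (n ∸ k) * b i) (ℕₚ.m∸[m∸n]≡n (ℕ.s≤s⁻¹ k<sn))) (ℤₚ.*-comm (a (n ∸ k)) (b k))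

∘-isMultiplier : ∀ {X Y} → IsMultiplier X → IsMultiplier Y → IsMultiplier (X ∘ Y)
∘-isMultiplier {X} {Y} isX isY = record
  { causal  = λ m eq → causal isX m (λ k k≤m → causal isY k (λ j j≤k → eq j (ℕₚ.≤-trans j≤k k≤m)))
  ; +ₛ-homo = λ f g n → trans (cong-≗ isX (+ₛ-homo isY f g) n) (+ₛ-homo isX (Y f) (Y g) n)
  ; ·ₛ-homo = λ c f n → trans (cong-≗ isX (·ₛ-homo isY c f) n) (·ₛ-homo isX c (Y f) n)
  ; x^-homo = λ e f n → trans (cong-≗ isX (x^-homo isY e f) n) (x^-homo isX e (Y f) n)
  }

multipliers-commute : ∀ {X Y} → IsMultiplier X → IsMultiplier Y → ∀ f → X (Y f) ≗ Y (X f)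
multipliers-commute {X} {Y} isX isY f m = begin
  X (Y f) m                    ≡⟨ multiplier-expansion (∘-isMultiplier isX isY) f m ⟩
  (f [x^ 1 ]· X (Y δ₀)) m      ≡⟨ ∑-cong (suc m) (λ k → cong (f k *_) (x^-cong (1 ℕ.* k) responses m)) ⟩
  (f [x^ 1 ]· Y (X δ₀)) m      ≡⟨ multiplier-expansion (∘-isMultiplier isY isX) f m ⟨
  Y (X f) m                    ∎
  where
  responses : X (Y δ₀) ≗ Y (X δ₀)
  responses n = begin
    X (Y δ₀) n               ≡⟨ multiplier-expansion isX (Y δ₀) n ⟩
    (Y δ₀ [x^ 1 ]· X δ₀) n   ≡⟨ [x^1]-comm (Y δ₀) (X δ₀) n ⟩
    (X δ₀ [x^ 1 ]· Y δ₀) n   ≡⟨ multiplier-expansion isY (X δ₀) n ⟨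
    Y (X δ₀) n               ∎

id-isMultiplier : IsMultiplier (λ f → f)
id-isMultiplier = record
  { causal  = λ m eq → eq m ℕₚ.≤-refl
  ; +ₛ-homo = λ f g n → refl
  ; ·ₛ-homo = λ c f n → refl
  ; x^-homo = λ e f n → refl
  }

x^-isMultiplier : ∀ e → IsMultiplier (x^ e ·_)
x^-isMultiplier e = record
  { causal  = x^-causal e
  ; +ₛ-homo = x^-plus e
  ; ·ₛ-homo = x^-scale e
  ; x^-homo = λ e′ f → x^-comm e e′ f
  }

0ₛ-isMultiplier : IsMultiplier (λ _ → 0ₛ)
0ₛ-isMultiplier = record
  { causal  = λ m eq → refl
  ; +ₛ-homo = λ f g n → refl
  ; ·ₛ-homo = λ c f n → sym (ℤₚ.*-zeroʳ c)
  ; x^-homo = λ e f n → sym (x^-zero e n)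
  }

+ₛ-isMultiplier : ∀ {X Y} → IsMultiplier X → IsMultiplier Y → IsMultiplier (λ f → X f +ₛ Y f)
+ₛ-isMultiplier {X} {Y} isX isY = record
  { causal  = λ m eq → cong₂ _+_ (causal isX m eq) (causal isY m eq)
  ; +ₛ-homo = λ f g n → trans (cong₂ _+_ (+ₛ-homo isX f g n) (+ₛ-homo isY f g n)) (interchange (X f n) (X g n) (Y f n) (Y g n))
  ; ·ₛ-homo = λ c f n → trans (cong₂ _+_ (·ₛ-homo isX c f n) (·ₛ-homo isY c f n)) (sym (ℤₚ.*-distribˡ-+ c _ _))
  ; x^-homo = λ e f n → trans (cong₂ _+_ (x^-homo isX e f n) (x^-homo isY e f n)) (sym (x^-plus e (X f) (Y f) n))
  }
  where
  interchange : ∀ a b c d → a + b + (c + d) ≡ a + c + (b + d)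
  interchange = solve-∀

-ₛ-isMultiplier : ∀ {X Y} → IsMultiplier X → IsMultiplier Y → IsMultiplier (λ f → X f -ₛ Y f)
-ₛ-isMultiplier {X} {Y} isX isY = record
  { causal  = λ m eq → cong₂ _-_ (causal isX m eq) (causal isY m eq)
  ; +ₛ-homo = λ f g n → trans (cong₂ _-_ (+ₛ-homo isX f g n) (+ₛ-homo isY f g n)) (interchange (X f n) (X g n) (Y f n) (Y g n))
  ; ·ₛ-homo = λ c f n → trans (cong₂ _-_ (·ₛ-homo isX c f n) (·ₛ-homo isY c f n)) (factor c _ _)
  ; x^-homo = λ e f n → trans (cong₂ _-_ (x^-homo isX e f n) (x^-homo isY e f n)) (sym (x^-minus e (X f) (Y f) n))
  }
  where
  interchange : ∀ a b c d → a + b - (c + d) ≡ a - c + (b - d)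
  interchange = solve-∀
  factor : ∀ c a b → c * a - c * b ≡ c * (a - b)
  factor = solve-∀

∑-isMultiplier : ∀ n (X : ℕ → Op) → (∀ k → IsMultiplier (X k)) → IsMultiplier (λ f m → ∑ n (λ k → X k f m))
∑-isMultiplier zero X isX = 0ₛ-isMultiplier
∑-isMultiplier (suc n) X isX = +ₛ-isMultiplier (isX 0) (∑-isMultiplier n (X ∘ suc) (isX ∘ suc))

-- Products of the factors 1 ± x^j

infixr 8 1-x^_·_ 1+x^_·_
1-x^_·_ 1+x^_·_ : ℕ → Op
1-x^ j · f = f -ₛ x^ j · f
1+x^ j · f = f +ₛ x^ j · f

1-x^-isMultiplier : ∀ j → IsMultiplier (1-x^ j ·_)
1-x^-isMultiplier j = -ₛ-isMultiplier id-isMultiplier (x^-isMultiplier j)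

1+x^-isMultiplier : ∀ j → IsMultiplier (1+x^ j ·_)
1+x^-isMultiplier j = +ₛ-isMultiplier id-isMultiplier (x^-isMultiplier j)

1-x^-invisible : ∀ j g {n} → n < j → (1-x^ j · g) n ≡ g n
1-x^-invisible j g n<j = trans (cong (_-_ (g _)) (x^-below j g n<j)) (ℤₚ.+-identityʳ _)

x^-1-x^ : ∀ e j h m → (x^ e · 1-x^ j · h) m ≡ (x^ e · h) m - (x^ (e ℕ.+ j) · h) m
x^-1-x^ e j h m = trans (x^-minus e h (x^ j · h) m) (cong (_-_ ((x^ e · h) m)) (x^-+ e j h m))

1-x^·1+x^ : ∀ j f → 1-x^ j · 1+x^ j · f ≗ 1-x^ (j ℕ.+ j) · f
1-x^·1+x^ j f n = begin
  f n + (x^ j · f) n - (x^ j · (1+x^ j · f)) n         ≡⟨ cong (_-_ (f n + (x^ j · f) n)) (x^-plus j f (x^ j · f) n) ⟩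
  f n + (x^ j · f) n - ((x^ j · f) n + (x^ j · x^ j · f) n) ≡⟨ telescope (f n) _ _ ⟩
  f n - (x^ j · x^ j · f) n                            ≡⟨ cong (_-_ (f n)) (x^-+ j j f n) ⟩
  f n - (x^ (j ℕ.+ j) · f) n                           ∎
  where
  telescope : ∀ a b c → a + b - (b + c) ≡ a - c
  telescope = solve-∀

∏ : (ℕ → Op) → List ℕ → Op
∏ F js f = foldr F f js

∏⁻ ∏⁺ : List ℕ → Op
∏⁻ = ∏ 1-x^_·_
∏⁺ = ∏ 1+x^_·_

range : ℕ → ℕ → List ℕ
range a zero = []
range a (suc n) = a ∷ range (suc a) n

range-+ : ∀ a n k → range a (n ℕ.+ k) ≡ range a n ++ range (a ℕ.+ n) k
range-+ a zero k = cong (λ b → range b k) (sym (ℕₚ.+-identityʳ a))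
range-+ a (suc n) k = cong (a ∷_) (trans (range-+ (suc a) n k) (cong (λ b → range (suc a) n ++ range b k) (sym (ℕₚ.+-suc a n))))

range-last : ∀ a n → range a (suc n) ≡ range a n ++ [ a ℕ.+ n ]
range-last a n = trans (cong (range a) (ℕₚ.+-comm 1 n)) (range-+ a n 1)

range-bounded : ∀ {P : ℕ → Set} a n → (∀ j → a ≤ j → P j) → All P (range a n)
range-bounded a zero bound = []
range-bounded a (suc n) bound = bound a ℕₚ.≤-refl ∷ range-bounded (suc a) n (λ j a<j → bound j (ℕₚ.<⇒≤ a<j))

module _ {F : ℕ → Op} (isF : ∀ j → IsMultiplier (F j)) where

  ∏-isMultiplier : ∀ js → IsMultiplier (∏ F js)
  ∏-isMultiplier [] = id-isMultiplier
  ∏-isMultiplier (j ∷ js) = ∘-isMultiplier (isF j) (∏-isMultiplier js)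

  ∏-++ : ∀ js ks f → ∏ F (js ++ ks) f ≡ ∏ F js (∏ F ks f)
  ∏-++ js ks f = Listₚ.foldr-++ F f js ks

  ∏-snoc : ∀ js j f → ∏ F (js ++ [ j ]) f ≗ F j (∏ F js f)
  ∏-snoc js j f n = trans (cong (λ h → h n) (∏-++ js [ j ] f)) (multipliers-commute (∏-isMultiplier js) (isF j) f n)

  ∏-range-last : ∀ a r f → ∏ F (range a (suc r)) f ≗ F (a ℕ.+ r) (∏ F (range a r) f)
  ∏-range-last a r f n = trans (cong (λ js → ∏ F js f n) (range-last a r)) (∏-snoc (range a r) (a ℕ.+ r) f n)

∏⁻-isMultiplier : ∀ js → IsMultiplier (∏⁻ js)
∏⁻-isMultiplier = ∏-isMultiplier 1-x^-isMultiplier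

∏⁺-isMultiplier : ∀ js → IsMultiplier (∏⁺ js)
∏⁺-isMultiplier = ∏-isMultiplier 1+x^-isMultiplier

∏⁻-invisible : ∀ {m} js g → All (m <_) js → ∏⁻ js g ≗[≤ m ] g
∏⁻-invisible [] g [] k k≤m = refl
∏⁻-invisible (j ∷ js) g (m<j ∷ m<js) k k≤m =
  trans (1-x^-invisible j (∏⁻ js g) (ℕₚ.≤-<-trans k≤m m<j)) (∏⁻-invisible js g m<js k k≤m)

-- Substituting x^d into a series

∑-x^ : ∀ N j (c : Series) (G : ℕ → ℤ) → ∑ N (λ k → (x^ j · c) k * G k) ≡ ∑ (N ∸ j) (λ k → c k * G (j ℕ.+ k))
∑-x^ N zero c G = refl
∑-x^ zero (suc j) c G = refl
∑-x^ (suc N) (suc j) c G = trans (ℤₚ.+-identityˡ _) (∑-x^ N j c (G ∘ suc))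

module _ (d : ℕ) where
  private
    D = suc d

  [x^]-bound : ∀ (c f : Series) {n B} → n < B → ∑ B (λ k → c k * (x^ (D ℕ.* k) · f) n) ≡ (c [x^ D ]· f) n
  [x^]-bound c f {n} n<B = ∑-extend (λ k → c k * (x^ (D ℕ.* k) · f) n) n<B
    (λ k n<k → *-x^-below (c k) (D ℕ.* k) f (ℕₚ.<-≤-trans n<k (ℕₚ.m≤n*m k D)))

  [x^]-causalˡ : ∀ {c c′ : Series} f n → c ≗[≤ n ] c′ → (c [x^ D ]· f) n ≡ (c′ [x^ D ]· f) n
  [x^]-causalˡ f n eq = ∑-cong-< (suc n) (λ k k<sn → cong (_* (x^ (D ℕ.* k) · f) n) (eq k (ℕ.s≤s⁻¹ k<sn)))

  [x^]-x^-homo : ∀ (c : Series) e f → c [x^ D ]· x^ e · f ≗ x^ e · (c [x^ D ]· f)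
  [x^]-x^-homo c e f n with ℕₚ.≤-<-connex e n
  ... | inj₁ e≤n = begin
    ∑ (suc n) (λ k → c k * (x^ (D ℕ.* k) · x^ e · f) n)      ≡⟨ ∑-cong (suc n) (λ k → cong (c k *_) (x^-comm (D ℕ.* k) e f n)) ⟩
    ∑ (suc n) (λ k → c k * (x^ e · x^ (D ℕ.* k) · f) n)      ≡⟨ ∑-cong (suc n) (λ k → cong (c k *_) (x^-above e (x^ (D ℕ.* k) · f) e≤n)) ⟩
    ∑ (suc n) (λ k → c k * (x^ (D ℕ.* k) · f) (n ∸ e))       ≡⟨ [x^]-bound c f (s≤s (ℕₚ.m∸n≤m n e)) ⟩
    (c [x^ D ]· f) (n ∸ e)                                   ≡⟨ x^-above e _ e≤n ⟨
    (x^ e · (c [x^ D ]· f)) n                                ∎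
  ... | inj₂ n<e = begin
    ∑ (suc n) (λ k → c k * (x^ (D ℕ.* k) · x^ e · f) n)      ≡⟨ ∑-zero (suc n) vanish ⟩
    + 0                                                      ≡⟨ x^-below e _ n<e ⟨
    (x^ e · (c [x^ D ]· f)) n                                ∎
    where
    vanish : ∀ k → c k * (x^ (D ℕ.* k) · x^ e · f) n ≡ + 0
    vanish k = trans (cong (c k *_) (x^-comm (D ℕ.* k) e f n)) (*-x^-below (c k) e _ n<e)

  [x^]-isMultiplier : ∀ (c : Series) → IsMultiplier (c [x^ D ]·_)
  [x^]-isMultiplier c = record
    { causal  = λ m eq → ∑-cong (suc m) (λ k → cong (c k *_) (x^-causal (D ℕ.* k) m eq))
    ; +ₛ-homo = λ f g n → trans (∑-cong (suc n) (λ k → trans (cong (c k *_) (x^-plus (D ℕ.* k) f g n)) (ℤₚ.*-distribˡ-+ (c k) (X f n k) (X g n k))))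
                                (∑-distrib-+ (suc n) (term f n) (term g n))
    ; ·ₛ-homo = λ a f n → trans (∑-cong (suc n) (λ k → trans (cong (c k *_) (x^-scale (D ℕ.* k) a f n)) (swap (c k) a (X f n k))))
                                (sym (*-distribˡ-∑ (suc n) a (term f n)))
    ; x^-homo = [x^]-x^-homo c
    }
    where
    X : Series → ℕ → ℕ → ℤ
    X f n k = (x^ (D ℕ.* k) · f) n
    term : Series → ℕ → ℕ → ℤ
    term f n k = c k * X f n k
    swap : ∀ a b x → a * (b * x) ≡ b * (a * x)
    swap = solve-∀

  δ₀-[x^] : ∀ f → δ₀ [x^ D ]· f ≗ f
  δ₀-[x^] f n = begin
    (δ₀ [x^ D ]· f) n                                   ≡⟨ cong₂ _+_ (trans (ℤₚ.*-identityˡ _) (cong (λ e → (x^ e · f) n) (ℕₚ.*-zeroʳ D)))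
                                                                  (∑-zero n (λ k → ℤₚ.*-zeroˡ ((x^ (D ℕ.* suc k) · f) n))) ⟩
    f n + + 0                                           ≡⟨ ℤₚ.+-identityʳ (f n) ⟩
    f n                                                 ∎

  x^-[x^] : ∀ j (c f : Series) → (x^ j · c) [x^ D ]· f ≗ x^ (D ℕ.* j) · (c [x^ D ]· f)
  x^-[x^] j c f n = begin
    ∑ (suc n) (λ k → (x^ j · c) k * (x^ (D ℕ.* k) · f) n)            ≡⟨ ∑-x^ (suc n) j c (λ k → (x^ (D ℕ.* k) · f) n) ⟩
    ∑ (suc n ∸ j) (λ k → c k * (x^ (D ℕ.* (j ℕ.+ k)) · f) n)         ≡⟨ ∑-extend (λ k → c k * (x^ (D ℕ.* (j ℕ.+ k)) · f) n) (ℕₚ.m∸n≤m (suc n) j) vanish ⟨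
    ∑ (suc n) (λ k → c k * (x^ (D ℕ.* (j ℕ.+ k)) · f) n)             ≡⟨ ∑-cong (suc n) (λ k → cong (c k *_) (split-exponent k)) ⟩
    (c [x^ D ]· x^ (D ℕ.* j) · f) n                                  ≡⟨ [x^]-x^-homo c (D ℕ.* j) f n ⟩
    (x^ (D ℕ.* j) · (c [x^ D ]· f)) n                                ∎
    where
    vanish : ∀ k → suc n ∸ j ≤ k → c k * (x^ (D ℕ.* (j ℕ.+ k)) · f) n ≡ + 0
    vanish k n-j≤k = *-x^-below (c k) (D ℕ.* (j ℕ.+ k)) f (ℕₚ.<-≤-trans n<j+k (ℕₚ.m≤n*m (j ℕ.+ k) D))
      where
      n<j+k : n < j ℕ.+ k
      n<j+k = ℕₚ.≤-trans (ℕₚ.m≤n+m∸n (suc n) j) (ℕₚ.+-monoʳ-≤ j n-j≤k)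
    split-exponent : ∀ k → (x^ (D ℕ.* (j ℕ.+ k)) · f) n ≡ (x^ (D ℕ.* k) · x^ (D ℕ.* j) · f) n
    split-exponent k = trans (cong (λ e → (x^ e · f) n) (trans (ℕₚ.*-distribˡ-+ D j k) (ℕₚ.+-comm (D ℕ.* j) _))) (sym (x^-+ (D ℕ.* k) _ f n))

  -ₛ-[x^] : ∀ (a b f : Series) → (a -ₛ b) [x^ D ]· f ≗ a [x^ D ]· f -ₛ b [x^ D ]· f
  -ₛ-[x^] a b f n = begin
    ∑ (suc n) (λ k → (a k - b k) * X k)            ≡⟨ ∑-cong (suc n) (λ k → distrib (a k) (b k) (X k)) ⟩
    ∑ (suc n) (λ k → a k * X k + - (b k * X k))    ≡⟨ ∑-distrib-+ (suc n) (λ k → a k * X k) (λ k → - (b k * X k)) ⟩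
    (a [x^ D ]· f) n + ∑ (suc n) (λ k → - (b k * X k))   ≡⟨ cong (_+_ ((a [x^ D ]· f) n)) (∑-neg (suc n) (λ k → b k * X k)) ⟩
    (a [x^ D ]· f) n - (b [x^ D ]· f) n            ∎
    where
    X : ℕ → ℤ
    X k = (x^ (D ℕ.* k) · f) n
    distrib : ∀ a b x → (a - b) * x ≡ a * x + - (b * x)
    distrib = solve-∀

  1-x^-[x^] : ∀ j (c f : Series) → (1-x^ j · c) [x^ D ]· f ≗ 1-x^ (D ℕ.* j) · (c [x^ D ]· f)
  1-x^-[x^] j c f n = trans (-ₛ-[x^] c (x^ j · c) f n) (cong (_-_ ((c [x^ D ]· f) n)) (x^-[x^] j c f n))

  ∏⁻-[x^] : ∀ js (c f : Series) → (∏⁻ js c) [x^ D ]· f ≗ ∏⁻ (map (D ℕ.*_) js) (c [x^ D ]· f)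
  ∏⁻-[x^] [] c f n = refl
  ∏⁻-[x^] (j ∷ js) c f n =
    trans (1-x^-[x^] j (∏⁻ js c) f n) (cong-≗ (1-x^-isMultiplier (D ℕ.* j)) (∏⁻-[x^] js c f) n)

  [x^]-coefficient : ∀ (c f : Series) t → (c [x^ D ]· f) t ≡ ∑ (suc (t / D)) (λ k → c k * f (t ∸ D ℕ.* k))
  [x^]-coefficient c f t = begin
    (c [x^ D ]· f) t                                         ≡⟨ ∑-extend (λ k → c k * (x^ (D ℕ.* k) · f) t) (s≤s (m/n≤m t D)) vanish ⟩
    ∑ (suc (t / D)) (λ k → c k * (x^ (D ℕ.* k) · f) t)       ≡⟨ ∑-cong-< (suc (t / D)) (λ k k≤t/D → cong (c k *_) (x^-above (D ℕ.* k) f (below k (ℕ.s≤s⁻¹ k≤t/D)))) ⟩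
    ∑ (suc (t / D)) (λ k → c k * f (t ∸ D ℕ.* k))            ∎
    where
    below : ∀ k → k ≤ t / D → D ℕ.* k ≤ t
    below k k≤t/D = ℕₚ.≤-trans (ℕₚ.*-monoʳ-≤ D k≤t/D) (ℕₚ.≤-trans (ℕₚ.≤-reflexive (ℕₚ.*-comm D (t / D))) (m/n*n≤m t D))
    vanish : ∀ k → suc (t / D) ≤ k → c k * (x^ (D ℕ.* k) · f) t ≡ + 0
    vanish k t/D<k = *-x^-below (c k) (D ℕ.* k) f (ℕₚ.≰⇒> (λ Dk≤t → ℕₚ.<⇒≱ t/D<k
      (subst (_≤ t / D) (m*n/n≡m k D) (/-monoˡ-≤ D (subst (_≤ t) (ℕₚ.*-comm D k) Dk≤t)))))

[x^1]-δ₀ : ∀ c → c [x^ 1 ]· δ₀ ≗ c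
[x^1]-δ₀ c n = begin
  (c [x^ 1 ]· δ₀) n                      ≡⟨ ∑-cong (suc n) (λ k → cong (λ e → c k * (x^ e · δ₀) n) (ℕₚ.*-identityˡ k)) ⟩
  ∑ (suc n) (λ k → c k * (x^ k · δ₀) n)  ≡⟨ ∑-x^-δ₀ (suc n) c (s≤s ℕₚ.≤-refl) ⟩
  c n                                    ∎

-- Euler's pentagonal number theorem

tri : ℕ → ℕ
tri zero = 0
tri (suc k) = tri k ℕ.+ suc k

sign : ℕ → ℤ
sign zero = + 1
sign (suc k) = - sign k

pent⁺ pent⁻ : ℕ → ℕ
pent⁺ k = k ℕ.* k ℕ.+ tri k
pent⁻ k = (k ∸ 1) ℕ.* k ℕ.+ tri k

pentagonalSum : ℕ → Op
pentagonalSum zero g = g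
pentagonalSum (suc n) g m = pentagonalSum n g m + sign (suc n) * ((x^ pent⁺ (suc n) · g) m + (x^ pent⁻ (suc n) · g) m)

∑-telescope : ∀ n (D : ℕ → ℤ) → ∑ n (λ k → D (suc k) - D k) ≡ D n - D 0
∑-telescope zero D = sym (ℤₚ.+-inverseʳ (D 0))
∑-telescope (suc n) D = begin
  D 1 - D 0 + ∑ n (λ k → D (suc (suc k)) - D (suc k))   ≡⟨ cong (_+_ (D 1 - D 0)) (∑-telescope n (D ∘ suc)) ⟩
  D 1 - D 0 + (D (suc n) - D 1)                         ≡⟨ collapse (D 0) (D 1) (D (suc n)) ⟩
  D (suc n) - D 0                                       ∎
  where
  collapse : ∀ a b c → b - a + (c - b) ≡ c - a
  collapse = solve-∀

-- From n to n + 1 each term changes by a difference of consecutive boundaryTerms, which telescopes.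
shanksTerm boundaryTerm : ℕ → Series → ℕ → Series
shanksTerm n g k = sign k ·ₛ x^ (n ℕ.* k ℕ.+ tri k) · ∏⁻ (range (suc k) (n ∸ k)) g
boundaryTerm n g k = sign k ·ₛ x^ (n ℕ.* k ℕ.+ tri k) · ∏⁻ (range k (suc n ∸ k)) g

shanksSum : ℕ → Op
shanksSum n g m = ∑ (suc n) (λ k → shanksTerm n g k m)

shanksTerm-step : ∀ n g m {k} → k ≤ n →
  shanksTerm (suc n) g k m ≡ shanksTerm n g k m + (boundaryTerm n g (suc k) m - boundaryTerm n g k m)
shanksTerm-step n g m {k} k≤n = begin
  shanksTerm (suc n) g k m                                                ≡⟨ cong (s *_) new-term ⟩
  s * (X₁ - X₂)                                                           ≡⟨ regroup s X₀ X₁ X₂ ⟩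
  s * X₀ + (- s * X₂ - s * (X₀ - X₁))                                     ≡⟨ cong (λ y → s * X₀ + (- s * X₂ - s * y)) old-boundary ⟨
  shanksTerm n g k m + (boundaryTerm n g (suc k) m - boundaryTerm n g k m) ∎
  where
  s = sign k
  h = ∏⁻ (range (suc k) (n ∸ k)) g
  E₀ = n ℕ.* k ℕ.+ tri k
  E₁ = suc n ℕ.* k ℕ.+ tri k
  E₂ = n ℕ.* suc k ℕ.+ tri (suc k)
  X₀ X₁ X₂ : ℤ
  X₀ = (x^ E₀ · h) m
  X₁ = (x^ E₁ · h) m
  X₂ = (x^ E₂ · h) m
  E₀+k≡E₁ : E₀ ℕ.+ k ≡ E₁
  E₀+k≡E₁ = arith n k (tri k)
    where
    arith : ∀ n k t → n ℕ.* k ℕ.+ t ℕ.+ k ≡ suc n ℕ.* k ℕ.+ t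
    arith = ℕ-Solver.solve-∀
  E₁+n+1≡E₂ : E₁ ℕ.+ (suc k ℕ.+ (n ∸ k)) ≡ E₂
  E₁+n+1≡E₂ = trans (cong (λ j → E₁ ℕ.+ suc j) (ℕₚ.m+[n∸m]≡n k≤n)) (arith n k (tri k))
    where
    arith : ∀ n k t → suc n ℕ.* k ℕ.+ t ℕ.+ suc n ≡ n ℕ.* suc k ℕ.+ (t ℕ.+ suc k)
    arith = ℕ-Solver.solve-∀
  new-term : (x^ E₁ · ∏⁻ (range (suc k) (suc n ∸ k)) g) m ≡ X₁ - X₂
  new-term = begin
    (x^ E₁ · ∏⁻ (range (suc k) (suc n ∸ k)) g) m     ≡⟨ cong (λ r → (x^ E₁ · ∏⁻ (range (suc k) r) g) m) (ℕₚ.+-∸-assoc 1 k≤n) ⟩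
    (x^ E₁ · ∏⁻ (range (suc k) (suc (n ∸ k))) g) m   ≡⟨ x^-cong E₁ (∏-range-last 1-x^-isMultiplier (suc k) (n ∸ k) g) m ⟩
    (x^ E₁ · 1-x^ (suc k ℕ.+ (n ∸ k)) · h) m         ≡⟨ x^-1-x^ E₁ (suc k ℕ.+ (n ∸ k)) h m ⟩
    X₁ - (x^ (E₁ ℕ.+ (suc k ℕ.+ (n ∸ k))) · h) m     ≡⟨ cong (λ e → X₁ - (x^ e · h) m) E₁+n+1≡E₂ ⟩
    X₁ - X₂                                          ∎
  old-boundary : (x^ E₀ · ∏⁻ (range k (suc n ∸ k)) g) m ≡ X₀ - X₁
  old-boundary = begin
    (x^ E₀ · ∏⁻ (range k (suc n ∸ k)) g) m           ≡⟨ cong (λ r → (x^ E₀ · ∏⁻ (range k r) g) m) (ℕₚ.+-∸-assoc 1 k≤n) ⟩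
    (x^ E₀ · 1-x^ k · h) m                           ≡⟨ x^-1-x^ E₀ k h m ⟩
    X₀ - (x^ (E₀ ℕ.+ k) · h) m                       ≡⟨ cong (λ e → X₀ - (x^ e · h) m) E₀+k≡E₁ ⟩
    X₀ - X₁                                          ∎
  regroup : ∀ s x₀ x₁ x₂ → s * (x₁ - x₂) ≡ s * x₀ + (- s * x₂ - s * (x₀ - x₁))
  regroup = solve-∀

boundaryTerm-zero : ∀ n g m → boundaryTerm n g 0 m ≡ + 0
boundaryTerm-zero n g m = trans (ℤₚ.*-identityˡ _) (trans (x^-minus (n ℕ.* 0 ℕ.+ 0) h h m) (ℤₚ.+-inverseʳ ((x^ (n ℕ.* 0 ℕ.+ 0) · h) m)))
  where
  h = ∏⁻ (range 1 n) g

∏⁻-empty-range : ∀ a n g → ∏⁻ (range a (n ∸ n)) g ≗ g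
∏⁻-empty-range a n g i = cong (λ r → ∏⁻ (range a r) g i) (ℕₚ.n∸n≡0 n)

shanks : ∀ n g → shanksSum n g ≗ pentagonalSum n g
shanks zero g m = trans (ℤₚ.+-identityʳ _) (ℤₚ.*-identityˡ (g m))
shanks (suc n) g m = begin
  shanksSum (suc n) g m                                                     ≡⟨ ∑-last (suc n) a ⟩
  ∑ (suc n) a + a (suc n)                                                   ≡⟨ cong (_+ a (suc n)) (∑-cong-< (suc n) (λ k k<sn → shanksTerm-step n g m (ℕ.s≤s⁻¹ k<sn))) ⟩
  ∑ (suc n) (λ k → b k + (D (suc k) - D k)) + a (suc n)                     ≡⟨ cong (_+ a (suc n)) (∑-distrib-+ (suc n) b (λ k → D (suc k) - D k)) ⟩
  shanksSum n g m + ∑ (suc n) (λ k → D (suc k) - D k) + a (suc n)           ≡⟨ cong₂ (λ x y → x + y + a (suc n)) (shanks n g m) (∑-telescope (suc n) D) ⟩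
  pentagonalSum n g m + (D (suc n) - D 0) + a (suc n)                       ≡⟨ cong₂ (λ x y → pentagonalSum n g m + (x - D 0) + y) D-last a-last ⟩
  pentagonalSum n g m + (s * X⁻ - D 0) + s * X⁺                             ≡⟨ cong (λ y → pentagonalSum n g m + (s * X⁻ - y) + s * X⁺) (boundaryTerm-zero n g m) ⟩
  pentagonalSum n g m + (s * X⁻ - + 0) + s * X⁺                             ≡⟨ collect (pentagonalSum n g m) s X⁻ X⁺ ⟩
  pentagonalSum (suc n) g m                                                 ∎
  where
  a b D : ℕ → ℤ
  a k = shanksTerm (suc n) g k m
  b k = shanksTerm n g k m
  D k = boundaryTerm n g k m
  s = sign (suc n)
  X⁺ = (x^ pent⁺ (suc n) · g) m
  X⁻ = (x^ pent⁻ (suc n) · g) m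
  a-last : a (suc n) ≡ s * X⁺
  a-last = cong (s *_) (x^-cong (pent⁺ (suc n)) (∏⁻-empty-range (suc (suc n)) n g) m)
  D-last : D (suc n) ≡ s * X⁻
  D-last = cong (s *_) (x^-cong (pent⁻ (suc n)) (∏⁻-empty-range (suc n) n g) m)
  collect : ∀ t s x y → t + (s * x - + 0) + s * y ≡ t + s * (y + x)
  collect = solve-∀

pentagonal-truncated : ∀ n g → ∏⁻ (range 1 n) g ≗[≤ n ] pentagonalSum n g
pentagonal-truncated n g m m≤n = begin
  ∏⁻ (range 1 n) g m                                          ≡⟨ ℤₚ.+-identityʳ _ ⟨
  ∏⁻ (range 1 n) g m + + 0                                    ≡⟨ cong₂ _+_ first (∑-zero n (λ k → *-x^-below (sign (suc k)) _ _ (far k))) ⟨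
  shanksSum n g m                                             ≡⟨ shanks n g m ⟩
  pentagonalSum n g m                                         ∎
  where
  first : shanksTerm n g 0 m ≡ ∏⁻ (range 1 n) g m
  first = trans (ℤₚ.*-identityˡ _) (cong (λ e → (x^ e · ∏⁻ (range 1 n) g) m) (trans (ℕₚ.+-identityʳ (n ℕ.* 0)) (ℕₚ.*-zeroʳ n)))
  far : ∀ k → m < n ℕ.* suc k ℕ.+ tri (suc k)
  far k = ℕₚ.≤-trans (s≤s m≤n) (subst (suc n ≤_) (sym (arith n k (tri k))) (ℕₚ.m≤m+n (suc n) _))
    where
    arith : ∀ n k t → n ℕ.* suc k ℕ.+ (t ℕ.+ suc k) ≡ suc n ℕ.+ (n ℕ.* k ℕ.+ t ℕ.+ k)
    arith = ℕ-Solver.solve-∀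

double-tri : ∀ k → tri k ℕ.* 2 ≡ k ℕ.* suc k
double-tri zero = refl
double-tri (suc k) = begin
  (tri k ℕ.+ suc k) ℕ.* 2          ≡⟨ ℕₚ.*-distribʳ-+ 2 (tri k) (suc k) ⟩
  tri k ℕ.* 2 ℕ.+ suc k ℕ.* 2      ≡⟨ cong (ℕ._+ suc k ℕ.* 2) (double-tri k) ⟩
  k ℕ.* suc k ℕ.+ suc k ℕ.* 2      ≡⟨ arith k ⟩
  suc k ℕ.* suc (suc k)            ∎
  where
  arith : ∀ k → k ℕ.* suc k ℕ.+ suc k ℕ.* 2 ≡ suc k ℕ.* suc (suc k)
  arith = ℕ-Solver.solve-∀

half-of-double : ∀ {a} b → a ≡ b ℕ.* 2 → a / 2 ≡ b
half-of-double b refl = m*n/n≡m b 2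

pent⁺-formula : ∀ k → (3 ℕ.* k ℕ.* k ℕ.+ k) / 2 ≡ pent⁺ k
pent⁺-formula k = half-of-double (pent⁺ k) (begin
  3 ℕ.* k ℕ.* k ℕ.+ k                    ≡⟨ arith k ⟩
  k ℕ.* k ℕ.* 2 ℕ.+ k ℕ.* suc k          ≡⟨ cong (k ℕ.* k ℕ.* 2 ℕ.+_) (double-tri k) ⟨
  k ℕ.* k ℕ.* 2 ℕ.+ tri k ℕ.* 2          ≡⟨ ℕₚ.*-distribʳ-+ 2 (k ℕ.* k) (tri k) ⟨
  pent⁺ k ℕ.* 2                          ∎)
  where
  arith : ∀ k → 3 ℕ.* k ℕ.* k ℕ.+ k ≡ k ℕ.* k ℕ.* 2 ℕ.+ k ℕ.* suc k
  arith = ℕ-Solver.solve-∀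

pent⁻-formula : ∀ k → (3 ℕ.* k ℕ.* k ∸ k) / 2 ≡ pent⁻ k
pent⁻-formula zero = refl
pent⁻-formula (suc k) = half-of-double (pent⁻ (suc k)) (begin
  3 ℕ.* suc k ℕ.* suc k ∸ suc k                                       ≡⟨ cong (_∸ suc k) (arith k) ⟩
  k ℕ.* suc k ℕ.* 2 ℕ.+ suc k ℕ.* suc (suc k) ℕ.+ suc k ∸ suc k       ≡⟨ ℕₚ.m+n∸n≡m _ (suc k) ⟩
  k ℕ.* suc k ℕ.* 2 ℕ.+ suc k ℕ.* suc (suc k)                         ≡⟨ cong (k ℕ.* suc k ℕ.* 2 ℕ.+_) (double-tri (suc k)) ⟨
  k ℕ.* suc k ℕ.* 2 ℕ.+ tri (suc k) ℕ.* 2                             ≡⟨ ℕₚ.*-distribʳ-+ 2 (k ℕ.* suc k) (tri (suc k)) ⟨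
  pent⁻ (suc k) ℕ.* 2                                                 ∎)
  where
  arith : ∀ k → 3 ℕ.* suc k ℕ.* suc k ≡ k ℕ.* suc k ℕ.* 2 ℕ.+ suc k ℕ.* suc (suc k) ℕ.+ suc k
  arith = ℕ-Solver.solve-∀

pentK-pent : ∀ m k → pentK m k ≡ ((pent⁺ k ≡ᵇ m) ∨ (pent⁻ k ≡ᵇ m))
pentK-pent m k = cong₂ (λ x y → (x ≡ᵇ m) ∨ (y ≡ᵇ m)) (pent⁺-formula k) (pent⁻-formula k)

isOdd-+2 : ∀ k → isOdd (suc (suc k)) ≡ isOdd k
isOdd-+2 k = cong (_≡ᵇ 1) (trans (cong (ℕ._% 2) (ℕₚ.+-comm 2 k)) ([m+n]%n≡m%n k 2))

sgn≡sign : ∀ k → sgn k ≡ sign k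
sgn≡sign zero = refl
sgn≡sign (suc zero) = refl
sgn≡sign (suc (suc k)) = begin
  (if isOdd (suc (suc k)) then - + 1 else + 1)   ≡⟨ cong (λ b → if b then - + 1 else + 1) (isOdd-+2 k) ⟩
  sgn k                                          ≡⟨ sgn≡sign k ⟩
  sign k                                         ≡⟨ ℤₚ.neg-involutive (sign k) ⟨
  sign (suc (suc k))                             ∎

pent⁻-suc : ∀ k → pent⁻ (suc k) ≡ pent⁺ k ℕ.+ suc (k ℕ.+ k)
pent⁻-suc k = arith k (tri k)
  where
  arith : ∀ k t → k ℕ.* suc k ℕ.+ (t ℕ.+ suc k) ≡ k ℕ.* k ℕ.+ t ℕ.+ suc (k ℕ.+ k)
  arith = ℕ-Solver.solve-∀

pent⁺-suc : ∀ k → pent⁺ (suc k) ≡ pent⁻ (suc k) ℕ.+ suc k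
pent⁺-suc k = arith k (tri k)
  where
  arith : ∀ k t → suc k ℕ.* suc k ℕ.+ (t ℕ.+ suc k) ≡ k ℕ.* suc k ℕ.+ (t ℕ.+ suc k) ℕ.+ suc k
  arith = ℕ-Solver.solve-∀

pent⁺<pent⁻-suc : ∀ k → pent⁺ k < pent⁻ (suc k)
pent⁺<pent⁻-suc k = subst (pent⁺ k <_) (sym (pent⁻-suc k)) (ℕₚ.m<m+n (pent⁺ k) (s≤s z≤n))

pent⁻<pent⁺ : ∀ k → pent⁻ (suc k) < pent⁺ (suc k)
pent⁻<pent⁺ k = subst (pent⁻ (suc k) <_) (sym (pent⁺-suc k)) (ℕₚ.m<m+n (pent⁻ (suc k)) (s≤s z≤n))

k<pent⁻-suc : ∀ k → k < pent⁻ (suc k)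
k<pent⁻-suc k = subst (k <_) (sym (pent⁻-suc k)) (ℕₚ.≤-trans (s≤s (ℕₚ.m≤m+n k k)) (ℕₚ.m≤n+m _ (pent⁺ k)))

pentagonalSum-above : ∀ K m → pent⁺ K < m → pentagonalSum K δ₀ m ≡ + 0
pentagonalSum-above zero (suc m) _ = refl
pentagonalSum-above (suc K) m pent⁺<m = begin
  pentagonalSum K δ₀ m + sign (suc K) * ((x^ pent⁺ (suc K) · δ₀) m + (x^ pent⁻ (suc K) · δ₀) m)
    ≡⟨ cong₂ (λ x y → x + sign (suc K) * y) (pentagonalSum-above K m earlier)
             (cong₂ _+_ (x^-δ₀-off _ (ℕₚ.<⇒≢ pent⁺<m)) (x^-δ₀-off _ (ℕₚ.<⇒≢ (ℕₚ.<-trans (pent⁻<pent⁺ K) pent⁺<m)))) ⟩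
  + 0 + sign (suc K) * + 0
    ≡⟨ trans (ℤₚ.+-identityˡ _) (ℤₚ.*-zeroʳ (sign (suc K))) ⟩
  + 0 ∎
  where
  earlier : pent⁺ K < m
  earlier = ℕₚ.<-trans (ℕₚ.<-trans (pent⁺<pent⁻-suc K) (pent⁻<pent⁺ K)) pent⁺<m

pentagonalSum-stable : ∀ K L m → m ≤ K → K ≤ L → pentagonalSum L δ₀ m ≡ pentagonalSum K δ₀ m
pentagonalSum-stable K L m m≤K K≤L with ℕₚ.m≤n⇒m<n∨m≡n K≤L
... | inj₂ refl = refl
... | inj₁ K<L@(s≤s {n = L′} K≤L′) = begin
  pentagonalSum L′ δ₀ m + sign L * ((x^ pent⁺ L · δ₀) m + (x^ pent⁻ L · δ₀) m)
    ≡⟨ cong (λ y → pentagonalSum L′ δ₀ m + sign L * y) (cong₂ _+_ (x^-below _ δ₀ (ℕₚ.<-trans far (pent⁻<pent⁺ L′))) (x^-below _ δ₀ far)) ⟩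
  pentagonalSum L′ δ₀ m + sign L * + 0
    ≡⟨ trans (cong (_+_ (pentagonalSum L′ δ₀ m)) (ℤₚ.*-zeroʳ (sign L))) (ℤₚ.+-identityʳ _) ⟩
  pentagonalSum L′ δ₀ m
    ≡⟨ pentagonalSum-stable K L′ m m≤K K≤L′ ⟩
  pentagonalSum K δ₀ m ∎
  where
  far : m < pent⁻ L
  far = ℕₚ.≤-<-trans (ℕₚ.≤-trans m≤K K≤L′) (k<pent⁻-suc L′)

pentagonalSum-first-hit : ∀ K {m} → pent⁺ K < m → pentagonalSum K δ₀ m + sign (suc K) * + 1 ≡ sgn (suc K)
pentagonalSum-first-hit K {m} lt = begin
  pentagonalSum K δ₀ m + sign (suc K) * + 1   ≡⟨ cong₂ _+_ (pentagonalSum-above K m lt) (ℤₚ.*-identityʳ (sign (suc K))) ⟩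
  + 0 + sign (suc K)                          ≡⟨ ℤₚ.+-identityˡ (sign (suc K)) ⟩
  sign (suc K)                                ≡⟨ sgn≡sign (suc K) ⟨
  sgn (suc K)                                 ∎

pentagonalSum-findPent : ∀ K {m} → 0 < m → pentagonalSum K δ₀ m ≡ findPent m K
pentagonalSum-findPent zero {suc m} _ = refl
pentagonalSum-findPent (suc K) {m} 0<m
  rewrite pentK-pent m (suc K) | x^-δ₀ (pent⁺ (suc K)) m | x^-δ₀ (pent⁻ (suc K)) m
  with pent⁺ (suc K) ≡ᵇ m in hit⁺ | pent⁻ (suc K) ≡ᵇ m in hit⁻
... | true | true = ⊥-elim (ℕₚ.<⇒≢ (pent⁻<pent⁺ K) (trans (≡ᵇ-sound hit⁻) (sym (≡ᵇ-sound hit⁺))))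
... | true | false = pentagonalSum-first-hit K (subst (pent⁺ K <_) (≡ᵇ-sound hit⁺) (ℕₚ.<-trans (pent⁺<pent⁻-suc K) (pent⁻<pent⁺ K)))
... | false | true = pentagonalSum-first-hit K (subst (pent⁺ K <_) (≡ᵇ-sound hit⁻) (pent⁺<pent⁻-suc K))
... | false | false = begin
  pentagonalSum K δ₀ m + sign (suc K) * (+ 0 + + 0)   ≡⟨ cong (_+_ (pentagonalSum K δ₀ m)) (ℤₚ.*-zeroʳ (sign (suc K))) ⟩
  pentagonalSum K δ₀ m + + 0                          ≡⟨ ℤₚ.+-identityʳ _ ⟩
  pentagonalSum K δ₀ m                                ≡⟨ pentagonalSum-findPent K 0<m ⟩
  findPent m K                                        ∎

ω-pentagonalSum : ∀ L {m} → m ≤ L → ω m ≡ pentagonalSum L δ₀ m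
ω-pentagonalSum L {zero} _ = sym (pentagonalSum-stable 0 L 0 z≤n z≤n)
ω-pentagonalSum L {suc m} m<L = begin
  findPent (suc m) (suc m)                ≡⟨ pentagonalSum-findPent (suc m) (s≤s z≤n) ⟨
  pentagonalSum (suc m) δ₀ (suc m)        ≡⟨ pentagonalSum-stable (suc m) L (suc m) ℕₚ.≤-refl m<L ⟨
  pentagonalSum L δ₀ (suc m)              ∎

pentagonal-number-theorem : ∀ L → ω ≗[≤ L ] ∏⁻ (range 1 L) δ₀
pentagonal-number-theorem L m m≤L = trans (ω-pentagonalSum L m≤L) (sym (pentagonal-truncated L δ₀ m m≤L))

-- Gauss's identity for triangular numbers

gaussianBinomial : ℕ → ℕ → Op
gaussianBinomial _ zero f = f
gaussianBinomial zero (suc i) f = 0ₛ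
gaussianBinomial (suc N) (suc i) f = gaussianBinomial N i f +ₛ x^ (suc i) · gaussianBinomial N (suc i) f

gaussianBinomial-above : ∀ N i f → N < i → gaussianBinomial N i f ≗ 0ₛ
gaussianBinomial-above zero (suc i) f _ n = refl
gaussianBinomial-above (suc N) (suc i) f (s≤s N<i) n = begin
  gaussianBinomial N i f n + (x^ suc i · gaussianBinomial N (suc i) f) n
    ≡⟨ cong₂ _+_ (gaussianBinomial-above N i f N<i n) (x^-cong (suc i) (gaussianBinomial-above N (suc i) f (ℕₚ.m<n⇒m<1+n N<i)) n) ⟩
  + 0 + (x^ suc i · 0ₛ) n
    ≡⟨ trans (ℤₚ.+-identityˡ _) (x^-zero (suc i) n) ⟩
  + 0 ∎

binomialSum : (ℕ → ℕ) → ℕ → Op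
binomialSum E N f n = ∑ (suc (suc N)) (λ i → (x^ E i · gaussianBinomial N i f) n)

binomialSum-cong : ∀ {E E′} N f → E ≗ E′ → binomialSum E N f ≗ binomialSum E′ N f
binomialSum-cong N f eq n = ∑-cong (suc (suc N)) (λ i → cong (λ e → (x^ e · gaussianBinomial N i f) n) (eq i))

binomialSum-x^ : ∀ a E N f → binomialSum (λ i → a ℕ.+ E i) N f ≗ x^ a · binomialSum E N f
binomialSum-x^ a E N f n = begin
  ∑ (suc (suc N)) (λ i → (x^ (a ℕ.+ E i) · gaussianBinomial N i f) n)    ≡⟨ ∑-cong (suc (suc N)) (λ i → x^-+ a (E i) (gaussianBinomial N i f) n) ⟨
  ∑ (suc (suc N)) (λ i → (x^ a · x^ E i · gaussianBinomial N i f) n)     ≡⟨ ∑-homo (x^-isMultiplier a) (suc (suc N)) (λ i → x^ E i · gaussianBinomial N i f) n ⟨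
  (x^ a · binomialSum E N f) n                                            ∎

-- Pascal's rule [N+1, i+1] = [N, i] + x^(i+1) [N, i+1], summed against x^(E i).
binomialSum-suc : ∀ E N f → binomialSum E (suc N) f ≗ binomialSum (E ∘ suc) N f +ₛ binomialSum (λ i → E i ℕ.+ i) N f
binomialSum-suc E N f n = begin
  binomialSum E (suc N) f n
    ≡⟨ cong (_+_ (x^-f 0)) (∑-cong (suc (suc N)) (λ i → x^-plus (E (suc i)) (G i) (x^ suc i · G (suc i)) n)) ⟩
  x^-f 0 + ∑ (suc (suc N)) (λ i → A i + B i)
    ≡⟨ cong (_+_ (x^-f 0)) (∑-distrib-+ (suc (suc N)) A B) ⟩
  x^-f 0 + (binomialSum (E ∘ suc) N f n + ∑ (suc (suc N)) B)
    ≡⟨ rotate (x^-f 0) (binomialSum (E ∘ suc) N f n) (∑ (suc (suc N)) B) ⟩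
  binomialSum (E ∘ suc) N f n + (x^-f 0 + ∑ (suc (suc N)) B)
    ≡⟨ cong (_+_ (binomialSum (E ∘ suc) N f n)) (cong₂ _+_ first-term (∑-cong (suc (suc N)) (λ i → x^-+ (E (suc i)) (suc i) (G (suc i)) n))) ⟩
  binomialSum (E ∘ suc) N f n + ∑ (suc (suc (suc N))) (λ i → (x^ (E i ℕ.+ i) · G i) n)
    ≡⟨ cong (_+_ (binomialSum (E ∘ suc) N f n)) drop-top ⟩
  binomialSum (E ∘ suc) N f n + binomialSum (λ i → E i ℕ.+ i) N f n ∎
  where
  G : ℕ → Series
  G i = gaussianBinomial N i f
  x^-f : ℕ → ℤ
  x^-f i = (x^ E i · f) n
  A B : ℕ → ℤ
  A i = (x^ E (suc i) · G i) n
  B i = (x^ E (suc i) · x^ suc i · G (suc i)) n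
  rotate : ∀ x y z → x + (y + z) ≡ y + (x + z)
  rotate = solve-∀
  first-term : x^-f 0 ≡ (x^ (E 0 ℕ.+ 0) · G 0) n
  first-term = cong (λ e → (x^ e · f) n) (sym (ℕₚ.+-identityʳ (E 0)))
  drop-top : ∑ (suc (suc (suc N))) (λ i → (x^ (E i ℕ.+ i) · G i) n) ≡ binomialSum (λ i → E i ℕ.+ i) N f n
  drop-top = ∑-extend (λ i → (x^ (E i ℕ.+ i) · G i) n) (ℕₚ.n≤1+n _) vanish
    where
    vanish : ∀ i → suc (suc N) ≤ i → (x^ (E i ℕ.+ i) · G i) n ≡ + 0
    vanish i N+1<i = trans (x^-cong (E i ℕ.+ i) (gaussianBinomial-above N i f (ℕₚ.<-trans (ℕₚ.n<1+n N) N+1<i)) n) (x^-zero (E i ℕ.+ i) n)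

x-binomial-theorem : ∀ c N f → binomialSum (λ i → tri i ℕ.+ c ℕ.* i) N f ≗ ∏⁺ (range (suc c) N) f
x-binomial-theorem c zero f n = begin
  binomialSum (λ i → tri i ℕ.+ c ℕ.* i) 0 f n
    ≡⟨ cong (_+_ ((x^ (c ℕ.* 0) · f) n)) (trans (ℤₚ.+-identityʳ _) (x^-zero (tri 1 ℕ.+ c ℕ.* 1) n)) ⟩
  (x^ (c ℕ.* 0) · f) n + + 0            ≡⟨ ℤₚ.+-identityʳ _ ⟩
  (x^ (c ℕ.* 0) · f) n                  ≡⟨ cong (λ e → (x^ e · f) n) (ℕₚ.*-zeroʳ c) ⟩
  f n                                   ∎
x-binomial-theorem c (suc N) f n = begin
  binomialSum E (suc N) f n                                        ≡⟨ binomialSum-suc E N f n ⟩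
  binomialSum (E ∘ suc) N f n + binomialSum (λ i → E i ℕ.+ i) N f n ≡⟨ cong₂ _+_ shifted-pattern next-pattern ⟩
  (x^ suc c · binomialSum E′ N f) n + binomialSum E′ N f n          ≡⟨ ℤₚ.+-comm ((x^ suc c · binomialSum E′ N f) n) (binomialSum E′ N f n) ⟩
  (1+x^ suc c · binomialSum E′ N f) n                              ≡⟨ cong-≗ (1+x^-isMultiplier (suc c)) (x-binomial-theorem (suc c) N f) n ⟩
  ∏⁺ (range (suc c) (suc N)) f n                                   ∎
  where
  E E′ : ℕ → ℕ
  E i = tri i ℕ.+ c ℕ.* i
  E′ i = tri i ℕ.+ suc c ℕ.* i
  shifted-pattern : binomialSum (E ∘ suc) N f n ≡ (x^ suc c · binomialSum E′ N f) n
  shifted-pattern = trans (binomialSum-cong N f (λ i → arith c i (tri i)) n) (binomialSum-x^ (suc c) E′ N f n)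
    where
    arith : ∀ c i t → t ℕ.+ suc i ℕ.+ c ℕ.* suc i ≡ suc c ℕ.+ (t ℕ.+ suc c ℕ.* i)
    arith = ℕ-Solver.solve-∀
  next-pattern : binomialSum (λ i → E i ℕ.+ i) N f n ≡ binomialSum E′ N f n
  next-pattern = binomialSum-cong N f (λ i → arith c i (tri i)) n
    where
    arith : ∀ c i t → t ℕ.+ c ℕ.* i ℕ.+ i ≡ t ℕ.+ suc c ℕ.* i
    arith = ℕ-Solver.solve-∀

-- shiftedTri a i = (i − a)(i − a + 1)/2, the triangular number of the integer i − a.
shiftedTri : ℕ → ℕ → ℕ
shiftedTri zero i = tri i
shiftedTri (suc a) zero = tri a
shiftedTri (suc a) (suc i) = shiftedTri a i

shiftedTri-suc : ∀ a i → shiftedTri (suc a) i ℕ.+ i ≡ a ℕ.+ shiftedTri a i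
shiftedTri-suc zero zero = refl
shiftedTri-suc zero (suc i) = refl
shiftedTri-suc (suc a) zero = trans (ℕₚ.+-identityʳ (tri (suc a))) (ℕₚ.+-comm (tri a) (suc a))
shiftedTri-suc (suc a) (suc i) = trans (ℕₚ.+-suc (shiftedTri (suc a) i) i) (cong suc (shiftedTri-suc a i))

cauchy-binomial : ∀ a N f → binomialSum (shiftedTri a) (a ℕ.+ N) f ≗ ∏⁺ (range 0 a) (∏⁺ (range 1 N) f)
cauchy-binomial zero N f n =
  trans (binomialSum-cong N f (λ i → sym (ℕₚ.+-identityʳ (tri i))) n) (x-binomial-theorem 0 N f n)
cauchy-binomial (suc a) N f n = begin
  binomialSum (shiftedTri (suc a)) (suc (a ℕ.+ N)) f n
    ≡⟨ binomialSum-suc (shiftedTri (suc a)) (a ℕ.+ N) f n ⟩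
  S n + binomialSum (λ i → shiftedTri (suc a) i ℕ.+ i) (a ℕ.+ N) f n
    ≡⟨ cong (_+_ (S n)) (trans (binomialSum-cong (a ℕ.+ N) f (shiftedTri-suc a) n) (binomialSum-x^ a (shiftedTri a) (a ℕ.+ N) f n)) ⟩
  (1+x^ a · S) n
    ≡⟨ cong-≗ (1+x^-isMultiplier a) (cauchy-binomial a N f) n ⟩
  (1+x^ a · ∏⁺ (range 0 a) h) n
    ≡⟨ ∏-range-last 1+x^-isMultiplier 0 a h n ⟨
  ∏⁺ (range 0 (suc a)) h n ∎
  where
  S = binomialSum (shiftedTri a) (a ℕ.+ N) f
  h = ∏⁺ (range 1 N) f


∏⁻-gaussianBinomial : ∀ i k g → ∏⁻ (range 1 i) (gaussianBinomial (i ℕ.+ k) i g) ≗ ∏⁻ (range (suc k) i) g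
∏⁻-gaussianBinomial zero k g n = refl
∏⁻-gaussianBinomial (suc i) zero g n = begin
  ∏⁻ (range 1 (suc i)) (G i +ₛ x^ suc i · G (suc i)) n   ≡⟨ cong-≗ (∏⁻-isMultiplier (range 1 (suc i))) drop-top n ⟩
  ∏⁻ (range 1 (suc i)) (G i) n                          ≡⟨ ∏-range-last 1-x^-isMultiplier 1 i (G i) n ⟩
  (1-x^ suc i · ∏⁻ (range 1 i) (G i)) n                 ≡⟨ cong-≗ (1-x^-isMultiplier (suc i)) (∏⁻-gaussianBinomial i 0 g) n ⟩
  (1-x^ suc i · ∏⁻ (range 1 i) g) n                     ≡⟨ ∏-range-last 1-x^-isMultiplier 1 i g n ⟨
  ∏⁻ (range 1 (suc i)) g n                              ∎
  where
  G : ℕ → Series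
  G j = gaussianBinomial (i ℕ.+ 0) j g
  drop-top : G i +ₛ x^ suc i · G (suc i) ≗ G i
  drop-top m = begin
    G i m + (x^ suc i · G (suc i)) m   ≡⟨ cong (_+_ (G i m)) (x^-cong (suc i) (gaussianBinomial-above (i ℕ.+ 0) (suc i) g (s≤s (ℕₚ.≤-reflexive (ℕₚ.+-identityʳ i)))) m) ⟩
    G i m + (x^ suc i · 0ₛ) m          ≡⟨ cong (_+_ (G i m)) (x^-zero (suc i) m) ⟩
    G i m + + 0                        ≡⟨ ℤₚ.+-identityʳ (G i m) ⟩
    G i m                              ∎
∏⁻-gaussianBinomial (suc i) (suc k) g n = begin
  P (gaussianBinomial (i ℕ.+ suc k) i g +ₛ x^ suc i · gaussianBinomial (i ℕ.+ suc k) (suc i) g) n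
    ≡⟨ +ₛ-homo (∏⁻-isMultiplier (range 1 (suc i))) _ _ n ⟩
  P (gaussianBinomial (i ℕ.+ suc k) i g) n + P (x^ suc i · gaussianBinomial (i ℕ.+ suc k) (suc i) g) n
    ≡⟨ cong₂ _+_ lower upper ⟩
  (h n - (x^ suc i · h) n) + (x^ suc i · (h -ₛ x^ suc k · h)) n
    ≡⟨ cong (_+_ (h n - (x^ suc i · h) n)) (x^-minus (suc i) h (x^ suc k · h) n) ⟩
  (h n - (x^ suc i · h) n) + ((x^ suc i · h) n - (x^ suc i · x^ suc k · h) n)
    ≡⟨ telescope (h n) _ _ ⟩
  h n - (x^ suc i · x^ suc k · h) n
    ≡⟨ cong (_-_ (h n)) (trans (x^-+ (suc i) (suc k) h n) (cong (λ e → (x^ e · h) n) (arith i k))) ⟩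
  (1-x^ (suc (suc k) ℕ.+ i) · h) n
    ≡⟨ ∏-range-last 1-x^-isMultiplier (suc (suc k)) i g n ⟨
  ∏⁻ (range (suc (suc k)) (suc i)) g n ∎
  where
  P = ∏⁻ (range 1 (suc i))
  h = ∏⁻ (range (suc (suc k)) i) g
  lower : P (gaussianBinomial (i ℕ.+ suc k) i g) n ≡ (h -ₛ x^ suc i · h) n
  lower = trans (∏-range-last 1-x^-isMultiplier 1 i _ n) (cong-≗ (1-x^-isMultiplier (suc i)) (∏⁻-gaussianBinomial i (suc k) g) n)
  upper : P (x^ suc i · gaussianBinomial (i ℕ.+ suc k) (suc i) g) n ≡ (x^ suc i · (h -ₛ x^ suc k · h)) n
  upper = begin
    P (x^ suc i · gaussianBinomial (i ℕ.+ suc k) (suc i) g) n   ≡⟨ x^-homo (∏⁻-isMultiplier (range 1 (suc i))) (suc i) _ n ⟩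
    (x^ suc i · P (gaussianBinomial (i ℕ.+ suc k) (suc i) g)) n ≡⟨ x^-cong (suc i) (λ m → cong (λ N → P (gaussianBinomial N (suc i) g) m) (ℕₚ.+-suc i k)) n ⟩
    (x^ suc i · P (gaussianBinomial (suc i ℕ.+ k) (suc i) g)) n ≡⟨ x^-cong (suc i) (∏⁻-gaussianBinomial (suc i) k g) n ⟩
    (x^ suc i · (h -ₛ x^ suc k · h)) n                         ∎
  telescope : ∀ a b c → (a - b) + (b - c) ≡ a - c
  telescope = solve-∀
  arith : ∀ i k → suc i ℕ.+ suc k ≡ suc (suc k) ℕ.+ i
  arith = ℕ-Solver.solve-∀

∏⁻∘∏⁺ : ∀ a n g → ∏⁻ (range a n) (∏⁺ (range a n) g) ≗ ∏⁻ (map (2 ℕ.*_) (range a n)) g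
∏⁻∘∏⁺ a zero g m = refl
∏⁻∘∏⁺ a (suc n) g m = begin
  (1-x^ a · ∏⁻ js (1+x^ a · ∏⁺ js g)) m          ≡⟨ cong-≗ (1-x^-isMultiplier a) (multipliers-commute (∏⁻-isMultiplier js) (1+x^-isMultiplier a) (∏⁺ js g)) m ⟩
  (1-x^ a · 1+x^ a · ∏⁻ js (∏⁺ js g)) m          ≡⟨ cong-≗ (∘-isMultiplier (1-x^-isMultiplier a) (1+x^-isMultiplier a)) (∏⁻∘∏⁺ (suc a) n g) m ⟩
  (1-x^ a · 1+x^ a · ∏⁻ js₂ g) m                 ≡⟨ 1-x^·1+x^ a (∏⁻ js₂ g) m ⟩
  (1-x^ (a ℕ.+ a) · ∏⁻ js₂ g) m                  ≡⟨ cong (λ e → (1-x^ e · ∏⁻ js₂ g) m) (cong (a ℕ.+_) (ℕₚ.+-identityʳ a)) ⟨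
  (1-x^ (2 ℕ.* a) · ∏⁻ js₂ g) m                  ∎
  where
  js = range (suc a) n
  js₂ = map (2 ℕ.*_) js

triangularSum : ℕ → Op
triangularSum L g m = ∑ L (λ k → (x^ tri k · g) m)

triangularSum-isMultiplier : ∀ L → IsMultiplier (triangularSum L)
triangularSum-isMultiplier L = ∑-isMultiplier L (λ k → x^ tri k ·_) (λ k → x^-isMultiplier (tri k))

n≤tri : ∀ n → n ≤ tri n
n≤tri zero = z≤n
n≤tri (suc n) = ℕₚ.m≤n+m (suc n) (tri n)

triangularSum-extend : ∀ g {t L M} → t < L → L ≤ M → triangularSum M g t ≡ triangularSum L g t
triangularSum-extend g {t} t<L L≤M = ∑-extend (λ k → (x^ tri k · g) t) L≤M
  (λ k L≤k → x^-below (tri k) g (ℕₚ.<-≤-trans t<L (ℕₚ.≤-trans L≤k (n≤tri k))))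

shiftedTri-below : ∀ {a i} → i < a → shiftedTri a i ≡ tri (a ∸ suc i)
shiftedTri-below {suc a} {zero} _ = refl
shiftedTri-below {suc a} {suc i} (s≤s i<a) = shiftedTri-below i<a

shiftedTri-above : ∀ a k → shiftedTri a (a ℕ.+ k) ≡ tri k
shiftedTri-above zero k = refl
shiftedTri-above (suc a) k = shiftedTri-above a k

∑-shiftedTri : ∀ a b (F : ℕ → ℤ) → ∑ (a ℕ.+ b) (F ∘ shiftedTri a) ≡ ∑ a (F ∘ tri) + ∑ b (F ∘ tri)
∑-shiftedTri a b F = begin
  ∑ (a ℕ.+ b) (F ∘ shiftedTri a)                                 ≡⟨ ∑-split a b (F ∘ shiftedTri a) ⟩
  ∑ a (F ∘ shiftedTri a) + ∑ b (λ k → F (shiftedTri a (a ℕ.+ k)))  ≡⟨ cong₂ _+_ lower (∑-cong b (λ k → cong F (shiftedTri-above a k))) ⟩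
  ∑ a (F ∘ tri) + ∑ b (F ∘ tri)                                  ∎
  where
  lower : ∑ a (F ∘ shiftedTri a) ≡ ∑ a (F ∘ tri)
  lower = trans (∑-cong-< a (λ i i<a → cong F (shiftedTri-below i<a))) (∑-reverse a (F ∘ tri))

shiftedTri-bound₁ : ∀ a i → a ≤ shiftedTri a i ℕ.+ suc i
shiftedTri-bound₁ zero i = z≤n
shiftedTri-bound₁ (suc a) zero = subst (suc a ≤_) (ℕₚ.+-comm 1 (tri a)) (s≤s (n≤tri a))
shiftedTri-bound₁ (suc a) (suc i) = subst (suc a ≤_) (sym (ℕₚ.+-suc (shiftedTri a i) (suc i))) (s≤s (shiftedTri-bound₁ a i))

shiftedTri-bound₂ : ∀ a i → i ≤ shiftedTri a i ℕ.+ a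
shiftedTri-bound₂ zero i = subst (i ≤_) (sym (ℕₚ.+-identityʳ (tri i))) (n≤tri i)
shiftedTri-bound₂ (suc a) zero = z≤n
shiftedTri-bound₂ (suc a) (suc i) = subst (suc i ≤_) (sym (ℕₚ.+-suc (shiftedTri a i) a)) (s≤s (shiftedTri-bound₂ a i))

∏⁻-gaussianBinomial-invisible : ∀ {t} i k g → t ≤ i → t < k →
  ∏⁻ (range 1 (i ℕ.+ k)) (gaussianBinomial (i ℕ.+ k) i g) ≗[≤ t ] g
∏⁻-gaussianBinomial-invisible {t} i k g t≤i t<k p p≤t = begin
  ∏⁻ (range 1 (i ℕ.+ k)) G p                      ≡⟨ cong (λ js → ∏⁻ js G p) (range-+ 1 i k) ⟩
  ∏⁻ (range 1 i ++ range (suc i) k) G p           ≡⟨ cong (λ h → h p) (∏-++ 1-x^-isMultiplier (range 1 i) (range (suc i) k) G) ⟩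
  ∏⁻ (range 1 i) (∏⁻ (range (suc i) k) G) p       ≡⟨ multipliers-commute (∏⁻-isMultiplier (range 1 i)) (∏⁻-isMultiplier (range (suc i) k)) G p ⟩
  ∏⁻ (range (suc i) k) (∏⁻ (range 1 i) G) p       ≡⟨ cong-≗ (∏⁻-isMultiplier (range (suc i) k)) (∏⁻-gaussianBinomial i k g) p ⟩
  ∏⁻ (range (suc i) k) (∏⁻ (range (suc k) i) g) p ≡⟨ ∏⁻-invisible (range (suc i) k) _ (range-bounded (suc i) k (λ j i<j → ℕₚ.<-≤-trans (s≤s t≤i) i<j)) p p≤t ⟩
  ∏⁻ (range (suc k) i) g p                        ≡⟨ ∏⁻-invisible (range (suc k) i) g (range-bounded (suc k) i (λ j k<j → ℕₚ.<-≤-trans (ℕₚ.m<n⇒m<1+n t<k) k<j)) p p≤t ⟩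
  g p                                             ∎
  where
  G = gaussianBinomial (i ℕ.+ k) i g

∏⁻-binomialSum-termwise : ∀ {t L} g → t ℕ.+ t < L →
  ∏⁻ (range 1 (L ℕ.+ L)) (binomialSum (shiftedTri L) (L ℕ.+ L) g) t ≡ triangularSum L g t + triangularSum L g t
∏⁻-binomialSum-termwise {t} {L} g 2t<L = begin
  Y (binomialSum (shiftedTri L) (L ℕ.+ L) g) t
    ≡⟨ ∑-homo (∏⁻-isMultiplier (range 1 (L ℕ.+ L))) (suc (suc (L ℕ.+ L))) (λ i → x^ shiftedTri L i · gaussianBinomial (L ℕ.+ L) i g) t ⟩
  ∑ (suc (suc (L ℕ.+ L))) (λ i → Y (x^ shiftedTri L i · gaussianBinomial (L ℕ.+ L) i g) t)
    ≡⟨ ∑-cong (suc (suc (L ℕ.+ L))) (λ i → trans (x^-homo (∏⁻-isMultiplier (range 1 (L ℕ.+ L))) (shiftedTri L i) _ t) (term i)) ⟩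
  ∑ (suc (suc (L ℕ.+ L))) (λ i → (x^ shiftedTri L i · g) t)
    ≡⟨ cong (λ b → ∑ b (λ i → (x^ shiftedTri L i · g) t)) (arith L) ⟩
  ∑ (L ℕ.+ suc (suc L)) (λ i → (x^ shiftedTri L i · g) t)
    ≡⟨ ∑-shiftedTri L (suc (suc L)) (λ e → (x^ e · g) t) ⟩
  triangularSum L g t + triangularSum (suc (suc L)) g t
    ≡⟨ cong (_+_ (triangularSum L g t)) (triangularSum-extend g t<L (ℕₚ.m≤n+m L 2)) ⟩
  triangularSum L g t + triangularSum L g t ∎
  where
  Y = ∏⁻ (range 1 (L ℕ.+ L))
  t<L : t < L
  t<L = ℕₚ.≤-<-trans (ℕₚ.m≤m+n t t) 2t<L
  arith : ∀ L → suc (suc (L ℕ.+ L)) ≡ L ℕ.+ suc (suc L)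
  arith = ℕ-Solver.solve-∀
  -- Only the i with shiftedTri L i ≤ t matter; for them t ≤ i < 2L − t,
  -- so (x;x)_{2L} [2L, i] ≡ 1 up to degree t.
  term : ∀ i → (x^ shiftedTri L i · Y (gaussianBinomial (L ℕ.+ L) i g)) t ≡ (x^ shiftedTri L i · g) t
  term i with ℕₚ.≤-<-connex (shiftedTri L i) t
  ... | inj₂ t<e = trans (x^-below _ _ t<e) (sym (x^-below _ g t<e))
  ... | inj₁ e≤t = trans (x^-above e _ e≤t) (trans (cancel (t ∸ e) (ℕₚ.m∸n≤m t e)) (sym (x^-above e g e≤t)))
    where
    e = shiftedTri L i
    i≤2L : i ≤ L ℕ.+ L
    i≤2L = ℕₚ.≤-trans (shiftedTri-bound₂ L i) (ℕₚ.+-monoˡ-≤ L (ℕₚ.≤-trans e≤t (ℕₚ.<⇒≤ t<L)))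
    t≤i : t ≤ i
    t≤i = ℕₚ.+-cancelˡ-≤ t t i (ℕ.s≤s⁻¹ (ℕₚ.≤-trans 2t<L (ℕₚ.≤-trans (shiftedTri-bound₁ L i)
            (ℕₚ.≤-trans (ℕₚ.+-monoˡ-≤ (suc i) e≤t) (ℕₚ.≤-reflexive (ℕₚ.+-suc t i))))))
    t<2L-i : t < L ℕ.+ L ∸ i
    t<2L-i = ℕₚ.+-cancelˡ-< i t (L ℕ.+ L ∸ i) (subst (i ℕ.+ t <_) (sym (ℕₚ.m+[n∸m]≡n i≤2L)) i+t<2L)
      where
      arith′ : ∀ t L → t ℕ.+ L ℕ.+ t ≡ L ℕ.+ (t ℕ.+ t)
      arith′ = ℕ-Solver.solve-∀
      i+t<2L : i ℕ.+ t < L ℕ.+ L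
      i+t<2L = ℕₚ.≤-<-trans (ℕₚ.≤-trans (ℕₚ.+-monoˡ-≤ t (ℕₚ.≤-trans (shiftedTri-bound₂ L i) (ℕₚ.+-monoˡ-≤ L e≤t))) (ℕₚ.≤-reflexive (arith′ t L)))
                             (ℕₚ.+-monoʳ-< L 2t<L)
    cancel : Y (gaussianBinomial (L ℕ.+ L) i g) ≗[≤ t ] g
    cancel = subst (λ N → ∏⁻ (range 1 N) (gaussianBinomial N i g) ≗[≤ t ] g) (ℕₚ.m+[n∸m]≡n i≤2L)
                   (∏⁻-gaussianBinomial-invisible i (L ℕ.+ L ∸ i) g t≤i t<2L-i)

∏⁻-binomialSum-productwise : ∀ {t} L′ g → t ≤ L′ →
  ∏⁻ (range 1 (suc L′ ℕ.+ suc L′)) (binomialSum (shiftedTri (suc L′)) (suc L′ ℕ.+ suc L′) g) t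
  ≡ (1+x^ 0 · ∏⁺ (range 1 L′) (∏⁻ (map (2 ℕ.*_) (range 1 (suc L′))) g)) t
∏⁻-binomialSum-productwise {t} L′ g t≤L′ = begin
  ∏⁻ (range 1 (L ℕ.+ L)) (binomialSum (shiftedTri L) (L ℕ.+ L) g) t
    ≡⟨ cong-≗ (∏⁻-isMultiplier (range 1 (L ℕ.+ L))) (cauchy-binomial L L g) t ⟩
  ∏⁻ (range 1 (L ℕ.+ L)) W t
    ≡⟨ cong (λ js → ∏⁻ js W t) (range-+ 1 L L) ⟩
  ∏⁻ (range 1 L ++ range (suc L) L) W t
    ≡⟨ cong (λ h → h t) (∏-++ 1-x^-isMultiplier (range 1 L) (range (suc L) L) W) ⟩
  ∏⁻ (range 1 L) (∏⁻ (range (suc L) L) W) t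
    ≡⟨ multipliers-commute (∏⁻-isMultiplier (range 1 L)) (∏⁻-isMultiplier (range (suc L) L)) W t ⟩
  ∏⁻ (range (suc L) L) (∏⁻ (range 1 L) W) t
    ≡⟨ ∏⁻-invisible (range (suc L) L) _ (range-bounded (suc L) L (λ j L<j → ℕₚ.<-trans (s≤s t≤L′) L<j)) t ℕₚ.≤-refl ⟩
  ∏⁻ (range 1 L) (1+x^ 0 · ∏⁺ (range 1 L′) (∏⁺ (range 1 L) g)) t
    ≡⟨ multipliers-commute (∏⁻-isMultiplier (range 1 L)) (∘-isMultiplier (1+x^-isMultiplier 0) (∏⁺-isMultiplier (range 1 L′))) _ t ⟩
  (1+x^ 0 · ∏⁺ (range 1 L′) (∏⁻ (range 1 L) (∏⁺ (range 1 L) g))) t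
    ≡⟨ cong-≗ (∘-isMultiplier (1+x^-isMultiplier 0) (∏⁺-isMultiplier (range 1 L′))) (∏⁻∘∏⁺ 1 L g) t ⟩
  (1+x^ 0 · ∏⁺ (range 1 L′) (∏⁻ (map (2 ℕ.*_) (range 1 L)) g)) t ∎
  where
  L = suc L′
  W = ∏⁺ (range 0 L) (∏⁺ (range 1 L) g)

-- Cauchy's finite triple product, multiplied by (x;x)_{2L}, evaluates in degree t to twice
-- either side (1 + x⁰ = 2).
gauss-triangular : ∀ {t} L′ g → t ℕ.+ t ≤ L′ →
  triangularSum (suc L′) g t ≡ ∏⁺ (range 1 L′) (∏⁻ (map (2 ℕ.*_) (range 1 (suc L′))) g) t
gauss-triangular {t} L′ g 2t≤L′ = double-cancel (begin
  triangularSum (suc L′) g t + triangularSum (suc L′) g t                     ≡⟨ ∏⁻-binomialSum-termwise g (s≤s 2t≤L′) ⟨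
  ∏⁻ (range 1 (suc L′ ℕ.+ suc L′)) (binomialSum (shiftedTri (suc L′)) (suc L′ ℕ.+ suc L′) g) t ≡⟨ ∏⁻-binomialSum-productwise L′ g (ℕₚ.≤-trans (ℕₚ.m≤m+n t t) 2t≤L′) ⟩
  (1+x^ 0 · ∏⁺ (range 1 L′) (∏⁻ (map (2 ℕ.*_) (range 1 (suc L′))) g)) t      ∎)
  where
  double-cancel : ∀ {x y} → x + x ≡ y + y → x ≡ y
  double-cancel {x} {y} eq = ℤₚ.*-cancelˡ-≡ (+ 2) x y (trans (double x) (trans eq (sym (double y))))
    where
    double : ∀ z → + 2 * z ≡ z + z
    double = solve-∀

tri-formula : ∀ k → (k ℕ.* (k ℕ.+ 1)) / 2 ≡ tri k
tri-formula k = half-of-double (tri k) (trans (cong (k ℕ.*_) (ℕₚ.+-comm k 1)) (sym (double-tri k)))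

tri-strictMono : ∀ {i j} → i < j → tri i < tri j
tri-strictMono {i} {suc j} (s≤s i≤j) with ℕₚ.m≤n⇒m<n∨m≡n i≤j
... | inj₁ i<j = ℕₚ.<-trans (tri-strictMono i<j) (ℕₚ.m<m+n (tri j) (s≤s z≤n))
... | inj₂ refl = ℕₚ.m<m+n (tri i) (s≤s z≤n)

anyUpTo-cong : ∀ n {P Q : ℕ → Bool} → P ≗ Q → anyUpTo n P ≡ anyUpTo n Q
anyUpTo-cong zero eq = eq 0
anyUpTo-cong (suc n) eq = cong₂ _∨_ (eq (suc n)) (anyUpTo-cong n eq)

∑-x^-tri-δ₀ : ∀ n m → ∑ (suc n) (λ i → (x^ tri i · δ₀) m) ≡ (if anyUpTo n (λ i → tri i ≡ᵇ m) then + 1 else + 0)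
∑-x^-tri-δ₀ zero m = trans (ℤₚ.+-identityʳ _) (x^-δ₀ 0 m)
∑-x^-tri-δ₀ (suc n) m rewrite ∑-last (suc n) (λ i → (x^ tri i · δ₀) m) | x^-δ₀ (tri (suc n)) m
  with tri (suc n) ≡ᵇ m in hit
... | true = cong (_+ + 1) (∑-zero-< (suc n) (λ i i<sn → x^-δ₀-off (tri i) (λ tri-i≡m →
               ℕₚ.<⇒≢ (tri-strictMono i<sn) (trans tri-i≡m (sym (≡ᵇ-sound hit))))))
... | false = trans (ℤₚ.+-identityʳ _) (∑-x^-tri-δ₀ n m)

δt-triangularSum : ∀ {m L} → m < L → δt m ≡ triangularSum L δ₀ m
δt-triangularSum {m} {L} m<L = begin
  (if anyUpTo m (λ k → k ℕ.* (k ℕ.+ 1) / 2 ≡ᵇ m) then + 1 else + 0)  ≡⟨ cong (λ b → if b then + 1 else + 0) (anyUpTo-cong m (λ k → cong (_≡ᵇ m) (tri-formula k))) ⟩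
  (if anyUpTo m (λ k → tri k ≡ᵇ m) then + 1 else + 0)                ≡⟨ ∑-x^-tri-δ₀ m m ⟨
  triangularSum (suc m) δ₀ m                                         ≡⟨ triangularSum-extend δ₀ ℕₚ.≤-refl m<L ⟨
  triangularSum L δ₀ m                                               ∎

-- Generating functions of partitions

countWhere-++ : ∀ P xs ys → countWhere P (xs ++ ys) ≡ countWhere P xs ℕ.+ countWhere P ys
countWhere-++ P [] ys = refl
countWhere-++ P (x ∷ xs) ys =
  trans (cong ((if P x then 1 else 0) ℕ.+_) (countWhere-++ P xs ys)) (sym (ℕₚ.+-assoc (if P x then 1 else 0) _ _))

countWhere-concatMap : ∀ P (g : ℕ → List (List ℕ)) h n →
  + countWhere P (concatMap g (applyUpTo h n)) ≡ ∑ n (λ j → + countWhere P (g (h j)))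
countWhere-concatMap P g h zero = refl
countWhere-concatMap P g h (suc n) = begin
  + countWhere P (g (h 0) ++ concatMap g (applyUpTo (h ∘ suc) n))                 ≡⟨ cong +_ (countWhere-++ P (g (h 0)) _) ⟩
  + (countWhere P (g (h 0)) ℕ.+ countWhere P (concatMap g (applyUpTo (h ∘ suc) n)))  ≡⟨ ℤₚ.pos-+ (countWhere P (g (h 0))) _ ⟩
  + countWhere P (g (h 0)) + + countWhere P (concatMap g (applyUpTo (h ∘ suc) n))   ≡⟨ cong (_+_ (+ countWhere P (g (h 0)))) (countWhere-concatMap P g (h ∘ suc) n) ⟩
  ∑ (suc n) (λ j → + countWhere P (g (h j)))                                       ∎

countWhere-concatMap-cong : ∀ P Q (g h : ℕ → List (List ℕ)) xs → (∀ x → countWhere P (g x) ≡ countWhere Q (h x)) →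
  countWhere P (concatMap g xs) ≡ countWhere Q (concatMap h xs)
countWhere-concatMap-cong P Q g h [] eq = refl
countWhere-concatMap-cong P Q g h (x ∷ xs) eq = begin
  countWhere P (g x ++ concatMap g xs)                   ≡⟨ countWhere-++ P (g x) _ ⟩
  countWhere P (g x) ℕ.+ countWhere P (concatMap g xs)   ≡⟨ cong₂ ℕ._+_ (eq x) (countWhere-concatMap-cong P Q g h xs eq) ⟩
  countWhere Q (h x) ℕ.+ countWhere Q (concatMap h xs)   ≡⟨ countWhere-++ Q (h x) _ ⟨
  countWhere Q (h x ++ concatMap h xs)                   ∎

countWhere-map-∷ : ∀ P a xs → countWhere P (map (a ∷_) xs) ≡ countWhere (P ∘ (a ∷_)) xs
countWhere-map-∷ P a [] = refl
countWhere-map-∷ P a (x ∷ xs) = cong ((if P (a ∷ x) then 1 else 0) ℕ.+_) (countWhere-map-∷ P a xs)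

countWhere-cong : ∀ {P Q} → P ≗ Q → ∀ xs → countWhere P xs ≡ countWhere Q xs
countWhere-cong eq [] = refl
countWhere-cong eq (x ∷ xs) = cong₂ ℕ._+_ (cong (λ b → if b then 1 else 0) (eq x)) (countWhere-cong eq xs)

countWhere-∧ : ∀ b R xs → countWhere (λ x → b ∧ R x) xs ≡ (if b then countWhere R xs else 0)
countWhere-∧ true R xs = refl
countWhere-∧ false R [] = refl
countWhere-∧ false R (x ∷ xs) = countWhere-∧ false R xs

countWhere-if : ∀ P b xs → + countWhere P (if b then xs else []) ≡ (if b then + countWhere P xs else + 0)
countWhere-if P true xs = refl
countWhere-if P false xs = refl

partsBounded-fuel : ∀ {f f′} m n → n ≤ f → n ≤ f′ → partsBounded f m n ≡ partsBounded f′ m n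
partsBounded-fuel m zero _ _ = refl
partsBounded-fuel {suc f} {suc f′} m (suc n) (s≤s n≤f) (s≤s n≤f′) = Listₚ.concatMap-cong part (upTo (suc n))
  where
  part : ∀ j → (if suc j ≤ᵇ m then map (suc j ∷_) (partsBounded f (suc j) (n ∸ j)) else [])
             ≡ (if suc j ≤ᵇ m then map (suc j ∷_) (partsBounded f′ (suc j) (n ∸ j)) else [])
  part j = cong (λ ps → if suc j ≤ᵇ m then map (suc j ∷_) ps else [])
                (partsBounded-fuel (suc j) (n ∸ j) (ℕₚ.≤-trans (ℕₚ.m∸n≤m n j) n≤f) (ℕₚ.≤-trans (ℕₚ.m∸n≤m n j) n≤f′))

headBelow : ℕ → List ℕ → Bool
headBelow a [] = true
headBelow a (b ∷ _) = b <ᵇ a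

strictlyDecreasing-∷ : ∀ a xs → strictlyDecreasing (a ∷ xs) ≡ headBelow a xs ∧ strictlyDecreasing xs
strictlyDecreasing-∷ a [] = refl
strictlyDecreasing-∷ a (b ∷ xs) = refl

<ᵇ-suc : ∀ j a → (j <ᵇ a) ≡ true → (j <ᵇ suc a) ≡ true
<ᵇ-suc zero (suc a) _ = refl
<ᵇ-suc (suc j) (suc a) j<a = <ᵇ-suc j a j<a

countWhere-headBelow : ∀ P f a r →
  countWhere (λ xs → headBelow (suc a) xs ∧ P xs) (partsBounded f (suc a) r) ≡ countWhere P (partsBounded f a r)
countWhere-headBelow P f a zero = refl
countWhere-headBelow P zero a (suc r) = refl
countWhere-headBelow P (suc f) a (suc r) =
  countWhere-concatMap-cong (λ xs → headBelow (suc a) xs ∧ P xs) P (parts (suc a)) (parts a) (upTo (suc r)) part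
  where
  parts : ℕ → ℕ → List (List ℕ)
  parts b j = if suc j ≤ᵇ b then map (suc j ∷_) (partsBounded f (suc j) (r ∸ j)) else []
  part : ∀ j → countWhere (λ xs → headBelow (suc a) xs ∧ P xs) (parts (suc a) j) ≡ countWhere P (parts a j)
  part j with j <ᵇ a in j<a
  ... | true rewrite <ᵇ-suc j a j<a = begin
    countWhere (λ xs → headBelow (suc a) xs ∧ P xs) (map (suc j ∷_) L)  ≡⟨ countWhere-map-∷ (λ xs → headBelow (suc a) xs ∧ P xs) (suc j) L ⟩
    countWhere (λ ys → (j <ᵇ a) ∧ P (suc j ∷ ys)) L                    ≡⟨ countWhere-cong (λ ys → cong (_∧ P (suc j ∷ ys)) j<a) L ⟩
    countWhere (P ∘ (suc j ∷_)) L                                      ≡⟨ countWhere-map-∷ P (suc j) L ⟨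
    countWhere P (map (suc j ∷_) L)                                    ∎
    where
    L = partsBounded f (suc j) (r ∸ j)
  ... | false with j <ᵇ suc a
  ...   | true = begin
    countWhere (λ xs → headBelow (suc a) xs ∧ P xs) (map (suc j ∷_) L)  ≡⟨ countWhere-map-∷ (λ xs → headBelow (suc a) xs ∧ P xs) (suc j) L ⟩
    countWhere (λ ys → (j <ᵇ a) ∧ P (suc j ∷ ys)) L                    ≡⟨ countWhere-cong (λ ys → cong (_∧ P (suc j ∷ ys)) j<a) L ⟩
    countWhere (λ ys → false ∧ P (suc j ∷ ys)) L                       ≡⟨ countWhere-∧ false (P ∘ (suc j ∷_)) L ⟩
    0                                                                  ∎
    where
    L = partsBounded f (suc j) (r ∸ j)
  ...   | false = refl

partitionCount : (List ℕ → Bool) → ℕ → Series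
partitionCount P m n = + countWhere P (partsBounded n m n)

partitionCount-unfold : ∀ P m n → partitionCount P m (suc n)
  ≡ ∑ (suc n) (λ j → if suc j ≤ᵇ m then + countWhere (P ∘ (suc j ∷_)) (partsBounded n (suc j) (n ∸ j)) else + 0)
partitionCount-unfold P m n = trans (countWhere-concatMap P parts (λ j → j) (suc n)) (∑-cong (suc n) part)
  where
  parts : ℕ → List (List ℕ)
  parts j = if suc j ≤ᵇ m then map (suc j ∷_) (partsBounded n (suc j) (n ∸ j)) else []
  part : ∀ j → + countWhere P (parts j)
             ≡ (if suc j ≤ᵇ m then + countWhere (P ∘ (suc j ∷_)) (partsBounded n (suc j) (n ∸ j)) else + 0)
  part j = trans (countWhere-if P (suc j ≤ᵇ m) (map (suc j ∷_) (partsBounded n (suc j) (n ∸ j))))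
                 (cong (λ c → if suc j ≤ᵇ m then + c else + 0) (countWhere-map-∷ P (suc j) (partsBounded n (suc j) (n ∸ j))))

∑-if-≤ᵇ-suc : ∀ m n (Y : ℕ → Series) →
  ∑ (suc n) (λ j → if suc j ≤ᵇ suc m then Y j (n ∸ j) else + 0)
  ≡ ∑ (suc n) (λ j → if suc j ≤ᵇ m then Y j (n ∸ j) else + 0) + (x^ m · Y m) n
∑-if-≤ᵇ-suc zero n Y = begin
  Y 0 n + ∑ n (λ _ → + 0)       ≡⟨ cong (_+_ (Y 0 n)) (∑-zero n (λ _ → refl)) ⟩
  Y 0 n + + 0                   ≡⟨ ℤₚ.+-comm (Y 0 n) (+ 0) ⟩
  + 0 + Y 0 n                   ≡⟨ cong (_+ Y 0 n) (∑-zero (suc n) (λ _ → refl)) ⟨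
  ∑ (suc n) (λ _ → + 0) + Y 0 n ∎
∑-if-≤ᵇ-suc (suc m) zero Y = sym (ℤₚ.+-identityʳ _)
∑-if-≤ᵇ-suc (suc m) (suc n) Y =
  trans (cong (_+_ (Y 0 (suc n))) (∑-if-≤ᵇ-suc m n (Y ∘ suc))) (sym (ℤₚ.+-assoc (Y 0 (suc n)) _ _))

-- The recursion behind all three counts: removing the largest part j + 1 from a partition
-- leaves a partition counted by Y j.
module PartitionRecurrence (P : List ℕ → Bool) (Y : ℕ → Series)
  (first-part : ∀ j {f r} → r ≤ f → + countWhere (P ∘ (suc j ∷_)) (partsBounded f (suc j) r) ≡ Y j r) where

  partitionCount-suc : ∀ m → partitionCount P (suc m) ≗ partitionCount P m +ₛ x^ suc m · Y m
  partitionCount-suc m zero = sym (ℤₚ.+-identityʳ _)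
  partitionCount-suc m (suc n) = begin
    partitionCount P (suc m) (suc n)                                         ≡⟨ unfold (suc m) ⟩
    ∑ (suc n) (λ j → if suc j ≤ᵇ suc m then Y j (n ∸ j) else + 0)           ≡⟨ ∑-if-≤ᵇ-suc m n Y ⟩
    ∑ (suc n) (λ j → if suc j ≤ᵇ m then Y j (n ∸ j) else + 0) + (x^ m · Y m) n ≡⟨ cong (_+ (x^ m · Y m) n) (unfold m) ⟨
    partitionCount P m (suc n) + (x^ m · Y m) n                             ∎
    where
    unfold : ∀ m → partitionCount P m (suc n) ≡ ∑ (suc n) (λ j → if suc j ≤ᵇ m then Y j (n ∸ j) else + 0)
    unfold m = trans (partitionCount-unfold P m n)
      (∑-cong (suc n) (λ j → cong (λ c → if suc j ≤ᵇ m then c else + 0) (first-part j (ℕₚ.m∸n≤m n j))))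

  partitionCount-zero : P [] ≡ true → partitionCount P 0 ≗ δ₀
  partitionCount-zero P[] zero = cong (λ b → + ((if b then 1 else 0) ℕ.+ 0)) P[]
  partitionCount-zero P[] (suc n) = trans (partitionCount-unfold P 0 n) (∑-zero (suc n) (λ _ → refl))

  partitionCount-stable : ∀ {n L} → n ≤ L → partitionCount P L n ≡ partitionCount P n n
  partitionCount-stable {n} {L} n≤L with ℕₚ.m≤n⇒m<n∨m≡n n≤L
  ... | inj₂ refl = refl
  ... | inj₁ (s≤s {n = L′} n≤L′) = begin
    partitionCount P (suc L′) n                  ≡⟨ partitionCount-suc L′ n ⟩
    partitionCount P L′ n + (x^ suc L′ · Y L′) n  ≡⟨ cong (_+_ (partitionCount P L′ n)) (x^-below (suc L′) (Y L′) (s≤s n≤L′)) ⟩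
    partitionCount P L′ n + + 0                  ≡⟨ ℤₚ.+-identityʳ _ ⟩
    partitionCount P L′ n                        ≡⟨ partitionCount-stable n≤L′ ⟩
    partitionCount P n n                         ∎

always distinctOdd : List ℕ → Bool
always _ = true
distinctOdd xs = strictlyDecreasing xs ∧ allOdd xs

distinctOdd-∷ : ∀ a xs → distinctOdd (a ∷ xs) ≡ isOdd a ∧ (headBelow a xs ∧ distinctOdd xs)
distinctOdd-∷ a xs = trans (cong (_∧ (isOdd a ∧ allOdd xs)) (strictlyDecreasing-∷ a xs)) (shuffle (headBelow a xs) (strictlyDecreasing xs) (isOdd a) (allOdd xs))
  where
  shuffle : ∀ h s o l → (h ∧ s) ∧ (o ∧ l) ≡ o ∧ (h ∧ (s ∧ l))
  shuffle h s true l = Boolₚ.∧-assoc h s l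
  shuffle h s false l = Boolₚ.∧-zeroʳ (h ∧ s)

always-first-part : ∀ j {f r} → r ≤ f → + countWhere (always ∘ (suc j ∷_)) (partsBounded f (suc j) r) ≡ partitionCount always (suc j) r
always-first-part j {r = r} r≤f = cong (λ ps → + countWhere always ps) (partsBounded-fuel (suc j) r r≤f ℕₚ.≤-refl)

distinct-first-part : ∀ j {f r} → r ≤ f →
  + countWhere (strictlyDecreasing ∘ (suc j ∷_)) (partsBounded f (suc j) r) ≡ partitionCount strictlyDecreasing j r
distinct-first-part j {f} {r} r≤f = cong +_ (begin
  countWhere (strictlyDecreasing ∘ (suc j ∷_)) (partsBounded f (suc j) r)                        ≡⟨ countWhere-cong (strictlyDecreasing-∷ (suc j)) (partsBounded f (suc j) r) ⟩
  countWhere (λ xs → headBelow (suc j) xs ∧ strictlyDecreasing xs) (partsBounded f (suc j) r)   ≡⟨ countWhere-headBelow strictlyDecreasing f j r ⟩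
  countWhere strictlyDecreasing (partsBounded f j r)                                            ≡⟨ cong (countWhere strictlyDecreasing) (partsBounded-fuel j r r≤f ℕₚ.≤-refl) ⟩
  countWhere strictlyDecreasing (partsBounded r j r)                                            ∎)

oddPart : ℕ → Series
oddPart j r = if isOdd (suc j) then partitionCount distinctOdd j r else + 0

distinctOdd-first-part : ∀ j {f r} → r ≤ f → + countWhere (distinctOdd ∘ (suc j ∷_)) (partsBounded f (suc j) r) ≡ oddPart j r
distinctOdd-first-part j {f} {r} r≤f = begin
  + countWhere (distinctOdd ∘ (suc j ∷_)) (partsBounded f (suc j) r)
    ≡⟨ cong +_ (countWhere-cong (distinctOdd-∷ (suc j)) (partsBounded f (suc j) r)) ⟩
  + countWhere (λ xs → isOdd (suc j) ∧ (headBelow (suc j) xs ∧ distinctOdd xs)) (partsBounded f (suc j) r)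
    ≡⟨ cong +_ (countWhere-∧ (isOdd (suc j)) (λ xs → headBelow (suc j) xs ∧ distinctOdd xs) (partsBounded f (suc j) r)) ⟩
  + (if isOdd (suc j) then countWhere (λ xs → headBelow (suc j) xs ∧ distinctOdd xs) (partsBounded f (suc j) r) else 0)
    ≡⟨ cong (λ c → + (if isOdd (suc j) then c else 0)) (trans (countWhere-headBelow distinctOdd f j r)
                                                              (cong (countWhere distinctOdd) (partsBounded-fuel j r r≤f ℕₚ.≤-refl))) ⟩
  + (if isOdd (suc j) then countWhere distinctOdd (partsBounded r j r) else 0)
    ≡⟨ +-if (isOdd (suc j)) ⟩
  oddPart j r ∎
  where
  +-if : ∀ b {c} → + (if b then c else 0) ≡ (if b then + c else + 0)
  +-if true = refl
  +-if false = refl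

module Unrestricted = PartitionRecurrence always (partitionCount always ∘ suc) always-first-part
module Distinct = PartitionRecurrence strictlyDecreasing (partitionCount strictlyDecreasing) distinct-first-part
module DistinctOdd = PartitionRecurrence distinctOdd oddPart distinctOdd-first-part

unrestricted-product : ∀ m → ∏⁻ (range 1 m) (partitionCount always m) ≗ δ₀
unrestricted-product zero = Unrestricted.partitionCount-zero refl
unrestricted-product (suc m) n = begin
  ∏⁻ (range 1 (suc m)) C n                    ≡⟨ ∏-range-last 1-x^-isMultiplier 1 m C n ⟩
  (1-x^ suc m · ∏⁻ (range 1 m) C) n           ≡⟨ multipliers-commute (1-x^-isMultiplier (suc m)) (∏⁻-isMultiplier (range 1 m)) C n ⟩
  ∏⁻ (range 1 m) (1-x^ suc m · C) n           ≡⟨ cong-≗ (∏⁻-isMultiplier (range 1 m)) remove-factor n ⟩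
  ∏⁻ (range 1 m) (partitionCount always m) n  ≡⟨ unrestricted-product m n ⟩
  δ₀ n                                        ∎
  where
  C = partitionCount always (suc m)
  remove-factor : 1-x^ suc m · C ≗ partitionCount always m
  remove-factor i = trans (cong (_- (x^ suc m · C) i) (Unrestricted.partitionCount-suc m i)) (cancel (partitionCount always m i) ((x^ suc m · C) i))
    where
    cancel : ∀ a b → a + b - b ≡ a
    cancel = solve-∀

distinct-product : ∀ m → partitionCount strictlyDecreasing m ≗ ∏⁺ (range 1 m) δ₀
distinct-product zero = Distinct.partitionCount-zero refl
distinct-product (suc m) n = begin
  partitionCount strictlyDecreasing (suc m) n     ≡⟨ Distinct.partitionCount-suc m n ⟩
  (1+x^ suc m · partitionCount strictlyDecreasing m) n ≡⟨ cong-≗ (1+x^-isMultiplier (suc m)) (distinct-product m) n ⟩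
  (1+x^ suc m · ∏⁺ (range 1 m) δ₀) n              ≡⟨ ∏-range-last 1+x^-isMultiplier 1 m δ₀ n ⟨
  ∏⁺ (range 1 (suc m)) δ₀ n                       ∎

alternate : Series → Series
alternate f n = sign n * f n

sign-+ : ∀ a b → sign (a ℕ.+ b) ≡ sign a * sign b
sign-+ zero b = sym (ℤₚ.*-identityˡ (sign b))
sign-+ (suc a) b = trans (cong -_ (sign-+ a b)) (ℤₚ.neg-distribˡ-* (sign a) (sign b))

sign-odd : ∀ K → sign (suc (K ℕ.+ K)) ≡ - + 1
sign-odd zero = refl
sign-odd (suc K) = begin
  - - sign (K ℕ.+ suc K)         ≡⟨ ℤₚ.neg-involutive _ ⟩
  sign (K ℕ.+ suc K)             ≡⟨ cong sign (ℕₚ.+-suc K K) ⟩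
  sign (suc (K ℕ.+ K))           ≡⟨ sign-odd K ⟩
  - + 1                          ∎

alternate-x^-odd : ∀ K f → alternate (x^ suc (K ℕ.+ K) · f) ≗ (λ n → - (x^ suc (K ℕ.+ K) · alternate f) n)
alternate-x^-odd K f n with ℕₚ.≤-<-connex (suc (K ℕ.+ K)) n
... | inj₂ n<a = trans (*-x^-below (sign n) _ f n<a) (cong -_ (sym (x^-below _ (alternate f) n<a)))
... | inj₁ a≤n = begin
  sign n * (x^ a · f) n                 ≡⟨ cong₂ _*_ (cong sign (sym (ℕₚ.m∸n+n≡m a≤n))) (x^-above a f a≤n) ⟩
  sign (n ∸ a ℕ.+ a) * f (n ∸ a)         ≡⟨ cong (_* f (n ∸ a)) (trans (sign-+ (n ∸ a) a) (cong (sign (n ∸ a) *_) (sign-odd K))) ⟩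
  sign (n ∸ a) * - + 1 * f (n ∸ a)       ≡⟨ flip (sign (n ∸ a)) (f (n ∸ a)) ⟩
  - (sign (n ∸ a) * f (n ∸ a))           ≡⟨ cong -_ (x^-above a (alternate f) a≤n) ⟨
  - (x^ a · alternate f) n               ∎
  where
  a = suc (K ℕ.+ K)
  flip : ∀ s x → s * - + 1 * x ≡ - (s * x)
  flip = solve-∀

odds : ℕ → List ℕ
odds zero = []
odds (suc K) = suc (K ℕ.+ K) ∷ odds K

isOdd-odd : ∀ K → isOdd (suc (K ℕ.+ K)) ≡ true
isOdd-odd zero = refl
isOdd-odd (suc K) = trans (cong (isOdd ∘ suc ∘ suc) (ℕₚ.+-suc K K)) (trans (isOdd-+2 (suc (K ℕ.+ K))) (isOdd-odd K))

isOdd-even : ∀ K → isOdd (K ℕ.+ K) ≡ false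
isOdd-even zero = refl
isOdd-even (suc K) = trans (cong (isOdd ∘ suc) (ℕₚ.+-suc K K)) (trans (isOdd-+2 (K ℕ.+ K)) (isOdd-even K))

distinctOdd-product : ∀ K → alternate (partitionCount distinctOdd (K ℕ.+ K)) ≗ ∏⁻ (odds K) δ₀
distinctOdd-product zero n = trans (cong (sign n *_) (DistinctOdd.partitionCount-zero refl n)) (sign-δ₀ n)
  where
  sign-δ₀ : ∀ n → sign n * δ₀ n ≡ δ₀ n
  sign-δ₀ zero = refl
  sign-δ₀ (suc n) = ℤₚ.*-zeroʳ (sign (suc n))
distinctOdd-product (suc K) n = begin
  sign n * C (suc K ℕ.+ suc K) n                 ≡⟨ cong (λ m → sign n * C m n) (cong suc (ℕₚ.+-suc K K)) ⟩
  sign n * C (suc (suc (K ℕ.+ K))) n             ≡⟨ cong (sign n *_) even-step ⟩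
  sign n * C (suc (K ℕ.+ K)) n                   ≡⟨ cong (sign n *_) odd-step ⟩
  sign n * (C (K ℕ.+ K) n + (x^ a · C (K ℕ.+ K)) n) ≡⟨ ℤₚ.*-distribˡ-+ (sign n) _ _ ⟩
  alternate (C (K ℕ.+ K)) n + alternate (x^ a · C (K ℕ.+ K)) n ≡⟨ cong (_+_ (alternate (C (K ℕ.+ K)) n)) (alternate-x^-odd K (C (K ℕ.+ K)) n) ⟩
  (1-x^ a · alternate (C (K ℕ.+ K))) n           ≡⟨ cong-≗ (1-x^-isMultiplier a) (distinctOdd-product K) n ⟩
  ∏⁻ (odds (suc K)) δ₀ n                         ∎
  where
  C = partitionCount distinctOdd
  a = suc (K ℕ.+ K)
  even-step : C (suc a) n ≡ C a n
  even-step = begin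
    C (suc a) n                    ≡⟨ DistinctOdd.partitionCount-suc a n ⟩
    C a n + (x^ suc a · oddPart a) n ≡⟨ cong (_+_ (C a n)) (x^-causal (suc a) n (λ r _ → cong (λ b → if b then C a r else + 0) (trans (isOdd-+2 (K ℕ.+ K)) (isOdd-even K)))) ⟩
    C a n + (x^ suc a · 0ₛ) n        ≡⟨ cong (_+_ (C a n)) (x^-zero (suc a) n) ⟩
    C a n + + 0                    ≡⟨ ℤₚ.+-identityʳ _ ⟩
    C a n                          ∎
  odd-step : C a n ≡ C (K ℕ.+ K) n + (x^ a · C (K ℕ.+ K)) n
  odd-step = trans (DistinctOdd.partitionCount-suc (K ℕ.+ K) n)
    (cong (_+_ (C (K ℕ.+ K) n)) (x^-causal a n (λ r _ → cong (λ b → if b then C (K ℕ.+ K) r else + 0) (isOdd-odd K))))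

∏⁻-odds-evens : ∀ K h → ∏⁻ (odds K) (∏⁻ (map (2 ℕ.*_) (range 1 K)) h) ≗ ∏⁻ (range 1 (K ℕ.+ K)) h
∏⁻-odds-evens zero h n = refl
∏⁻-odds-evens (suc K) h n = begin
  (1-x^ a · ∏⁻ (odds K) (∏⁻ (map (2 ℕ.*_) (range 1 (suc K))) h)) n
    ≡⟨ cong-≗ (∘-isMultiplier (1-x^-isMultiplier a) (∏⁻-isMultiplier (odds K))) new-even n ⟩
  (1-x^ a · ∏⁻ (odds K) (1-x^ suc a · ∏⁻ (map (2 ℕ.*_) (range 1 K)) h)) n
    ≡⟨ cong-≗ (1-x^-isMultiplier a) (multipliers-commute (∏⁻-isMultiplier (odds K)) (1-x^-isMultiplier (suc a)) _) n ⟩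
  (1-x^ a · 1-x^ suc a · ∏⁻ (odds K) (∏⁻ (map (2 ℕ.*_) (range 1 K)) h)) n
    ≡⟨ cong-≗ (∘-isMultiplier (1-x^-isMultiplier a) (1-x^-isMultiplier (suc a))) (∏⁻-odds-evens K h) n ⟩
  (1-x^ a · 1-x^ suc a · ∏⁻ (range 1 (K ℕ.+ K)) h) n
    ≡⟨ multipliers-commute (1-x^-isMultiplier a) (1-x^-isMultiplier (suc a)) (∏⁻ (range 1 (K ℕ.+ K)) h) n ⟩
  (1-x^ suc a · 1-x^ a · ∏⁻ (range 1 (K ℕ.+ K)) h) n
    ≡⟨ cong-≗ (1-x^-isMultiplier (suc a)) (∏-range-last 1-x^-isMultiplier 1 (K ℕ.+ K) h) n ⟨
  (1-x^ suc a · ∏⁻ (range 1 a) h) n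
    ≡⟨ ∏-range-last 1-x^-isMultiplier 1 a h n ⟨
  ∏⁻ (range 1 (suc a)) h n
    ≡⟨ cong (λ m → ∏⁻ (range 1 (suc m)) h n) (ℕₚ.+-suc K K) ⟨
  ∏⁻ (range 1 (suc K ℕ.+ suc K)) h n ∎
  where
  a = suc (K ℕ.+ K)
  new-even : ∏⁻ (map (2 ℕ.*_) (range 1 (suc K))) h ≗ 1-x^ suc a · ∏⁻ (map (2 ℕ.*_) (range 1 K)) h
  new-even m = begin
    ∏⁻ (map (2 ℕ.*_) (range 1 (suc K))) h m                 ≡⟨ cong (λ js → ∏⁻ (map (2 ℕ.*_) js) h m) (range-last 1 K) ⟩
    ∏⁻ (map (2 ℕ.*_) (range 1 K ++ [ suc K ])) h m          ≡⟨ cong (λ js → ∏⁻ js h m) (Listₚ.map-++ (2 ℕ.*_) (range 1 K) [ suc K ]) ⟩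
    ∏⁻ (map (2 ℕ.*_) (range 1 K) ++ [ 2 ℕ.* suc K ]) h m    ≡⟨ ∏-snoc 1-x^-isMultiplier (map (2 ℕ.*_) (range 1 K)) (2 ℕ.* suc K) h m ⟩
    (1-x^ (2 ℕ.* suc K) · ∏⁻ (map (2 ℕ.*_) (range 1 K)) h) m ≡⟨ cong (λ e → (1-x^ e · ∏⁻ (map (2 ℕ.*_) (range 1 K)) h) m) (arith K) ⟩
    (1-x^ suc a · ∏⁻ (map (2 ℕ.*_) (range 1 K)) h) m         ∎
    where
    arith : ∀ K → 2 ℕ.* suc K ≡ suc (suc (K ℕ.+ K))
    arith = ℕ-Solver.solve-∀

euler-odd-distinct : ∀ K h → ∏⁺ (range 1 (K ℕ.+ K)) (∏⁻ (odds K) (∏⁻ (map (2 ℕ.*_) (range 1 K)) h))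
                            ≗ ∏⁻ (map (2 ℕ.*_) (range 1 (K ℕ.+ K))) h
euler-odd-distinct K h n = begin
  ∏⁺ (range 1 (K ℕ.+ K)) (∏⁻ (odds K) (∏⁻ (map (2 ℕ.*_) (range 1 K)) h)) n  ≡⟨ cong-≗ (∏⁺-isMultiplier (range 1 (K ℕ.+ K))) (∏⁻-odds-evens K h) n ⟩
  ∏⁺ (range 1 (K ℕ.+ K)) (∏⁻ (range 1 (K ℕ.+ K)) h) n                      ≡⟨ multipliers-commute (∏⁺-isMultiplier (range 1 (K ℕ.+ K))) (∏⁻-isMultiplier (range 1 (K ℕ.+ K))) h n ⟩
  ∏⁻ (range 1 (K ℕ.+ K)) (∏⁺ (range 1 (K ℕ.+ K)) h) n                      ≡⟨ ∏⁻∘∏⁺ 1 (K ℕ.+ K) h n ⟩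
  ∏⁻ (map (2 ℕ.*_) (range 1 (K ℕ.+ K))) h n                                ∎

ω-[x^] : ∀ d f {t L} → t ≤ L → (ω [x^ suc d ]· f) t ≡ ∏⁻ (map (suc d ℕ.*_) (range 1 L)) f t
ω-[x^] d f {t} {L} t≤L = begin
  (ω [x^ suc d ]· f) t                                       ≡⟨ [x^]-causalˡ d f t (λ k k≤t → pentagonal-number-theorem L k (ℕₚ.≤-trans k≤t t≤L)) ⟩
  (∏⁻ (range 1 L) δ₀ [x^ suc d ]· f) t                       ≡⟨ ∏⁻-[x^] d (range 1 L) δ₀ f t ⟩
  ∏⁻ (map (suc d ℕ.*_) (range 1 L)) (δ₀ [x^ suc d ]· f) t    ≡⟨ cong-≗ (∏⁻-isMultiplier (map (suc d ℕ.*_) (range 1 L))) (δ₀-[x^] d f) t ⟩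
  ∏⁻ (map (suc d ℕ.*_) (range 1 L)) f t                      ∎

ω[x^2]-δ₀ : ∀ t → (ω [x^ 2 ]· δ₀) t ≡ (if isOdd t then + 0 else ω (t / 2))
ω[x^2]-δ₀ t = begin
  (ω [x^ 2 ]· δ₀) t                                         ≡⟨ [x^]-coefficient 1 ω δ₀ t ⟩
  ∑ (suc h) (λ k → ω k * δ₀ (t ∸ 2 ℕ.* k))                  ≡⟨ ∑-last h (λ k → ω k * δ₀ (t ∸ 2 ℕ.* k)) ⟩
  ∑ h (λ k → ω k * δ₀ (t ∸ 2 ℕ.* k)) + ω h * δ₀ (t ∸ 2 ℕ.* h) ≡⟨ cong₂ _+_ (∑-zero-< h earlier) (cong (λ r → ω h * δ₀ r) remainder) ⟩
  + 0 + ω h * δ₀ (t ℕ.% 2)                                   ≡⟨ ℤₚ.+-identityˡ _ ⟩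
  ω h * δ₀ (t ℕ.% 2)                                         ≡⟨ by-remainder (t ℕ.% 2) (m%n<n t 2) ⟩
  (if isOdd t then + 0 else ω h)                             ∎
  where
  h = t / 2
  2h≤t : 2 ℕ.* h ≤ t
  2h≤t = subst (_≤ t) (ℕₚ.*-comm h 2) (m/n*n≤m t 2)
  earlier : ∀ k → k < h → ω k * δ₀ (t ∸ 2 ℕ.* k) ≡ + 0
  earlier k k<h = trans (cong (ω k *_) (δ₀-positive (ℕₚ.m<n⇒0<n∸m (ℕₚ.<-≤-trans (ℕₚ.*-monoʳ-< 2 k<h) 2h≤t)))) (ℤₚ.*-zeroʳ (ω k))
    where
    δ₀-positive : ∀ {n} → 0 < n → δ₀ n ≡ + 0
    δ₀-positive {suc n} _ = refl
  remainder : t ∸ 2 ℕ.* h ≡ t ℕ.% 2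
  remainder = trans (cong (t ∸_) (ℕₚ.*-comm 2 h)) (sym (m%n≡m∸m/n*n t 2))
  by-remainder : ∀ r → r < 2 → ω h * δ₀ r ≡ (if r ≡ᵇ 1 then + 0 else ω h)
  by-remainder zero _ = ℤₚ.*-identityʳ (ω h)
  by-remainder (suc zero) _ = ℤₚ.*-zeroʳ (ω h)
  by-remainder (suc (suc r)) (s≤s (s≤s ()))

sumTo-∑ : ∀ N f → sumTo N f ≡ ∑ (suc N) f
sumTo-∑ zero f = sym (ℤₚ.+-identityʳ (f 0))
sumTo-∑ (suc N) f = trans (cong (_+ f (suc N)) (sumTo-∑ N f)) (sym (∑-last (suc N) f))

q≡∏⁺ : ∀ {n L} → n ≤ L → + q n ≡ ∏⁺ (range 1 L) δ₀ n
q≡∏⁺ {n} {L} n≤L = trans (sym (Distinct.partitionCount-stable n≤L)) (distinct-product L n)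

p≡partitionCount : ∀ {n L} → n ≤ L → + p n ≡ partitionCount always L n
p≡partitionCount {n} n≤L = trans (cong +_ (length≡countWhere (partsBounded n n n))) (sym (Unrestricted.partitionCount-stable n≤L))
  where
  length≡countWhere : ∀ (xss : List (List ℕ)) → length xss ≡ countWhere always xss
  length≡countWhere [] = refl
  length≡countWhere (_ ∷ xss) = cong suc (length≡countWhere xss)

qq≡alternate : ∀ {n L} → n ≤ L → negOnePow n * + qq n ≡ alternate (partitionCount distinctOdd L) n
qq≡alternate {n} n≤L = cong₂ _*_ (sgn≡sign n) (sym (DistinctOdd.partitionCount-stable n≤L))

∏⁻-evens-truncate : ∀ {t M} Y → t ≤ M → ∏⁻ (map (2 ℕ.*_) (range 1 M)) Y ≗[≤ t ] ∏⁻ (map (2 ℕ.*_) (range 1 t)) Y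
∏⁻-evens-truncate {t} {M} Y t≤M k k≤t = begin
  ∏⁻ (map (2 ℕ.*_) (range 1 M)) Y k                              ≡⟨ cong (λ m → ∏⁻ (map (2 ℕ.*_) (range 1 m)) Y k) (ℕₚ.m+[n∸m]≡n t≤M) ⟨
  ∏⁻ (map (2 ℕ.*_) (range 1 (t ℕ.+ (M ∸ t)))) Y k                ≡⟨ cong (λ js → ∏⁻ (map (2 ℕ.*_) js) Y k) (range-+ 1 t (M ∸ t)) ⟩
  ∏⁻ (map (2 ℕ.*_) (range 1 t ++ high)) Y k                      ≡⟨ cong (λ js → ∏⁻ js Y k) (Listₚ.map-++ (2 ℕ.*_) (range 1 t) high) ⟩
  ∏⁻ (map (2 ℕ.*_) (range 1 t) ++ map (2 ℕ.*_) high) Y k         ≡⟨ cong (λ h → h k) (∏-++ 1-x^-isMultiplier (map (2 ℕ.*_) (range 1 t)) (map (2 ℕ.*_) high) Y) ⟩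
  ∏⁻ (map (2 ℕ.*_) (range 1 t)) (∏⁻ (map (2 ℕ.*_) high) Y) k     ≡⟨ causal (∏⁻-isMultiplier (map (2 ℕ.*_) (range 1 t))) k (λ i i≤k → ∏⁻-invisible _ Y invisible i (ℕₚ.≤-trans i≤k k≤t)) ⟩
  ∏⁻ (map (2 ℕ.*_) (range 1 t)) Y k                              ∎
  where
  high = range (suc t) (M ∸ t)
  invisible : All (t <_) (map (2 ℕ.*_) high)
  invisible = Allₚ.map⁺ (range-bounded (suc t) (M ∸ t) (λ j t<j → ℕₚ.<-≤-trans t<j (ℕₚ.m≤n*m j 2)))

q-ω-identity : ∀ t → sumTo (t / 2) (λ k → (+ q (t ∸ 2 ℕ.* k)) * ω k) ≡ δt t
q-ω-identity t = begin
  sumTo (t / 2) (λ k → + q (t ∸ 2 ℕ.* k) * ω k)     ≡⟨ sumTo-∑ (t / 2) (λ k → + q (t ∸ 2 ℕ.* k) * ω k) ⟩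
  ∑ (suc (t / 2)) (λ k → + q (t ∸ 2 ℕ.* k) * ω k)   ≡⟨ ∑-cong (suc (t / 2)) (λ k → ℤₚ.*-comm (Q (t ∸ 2 ℕ.* k)) (ω k)) ⟩
  ∑ (suc (t / 2)) (λ k → ω k * Q (t ∸ 2 ℕ.* k))     ≡⟨ [x^]-coefficient 1 ω Q t ⟨
  (ω [x^ 2 ]· Q) t                                  ≡⟨ ω-[x^] 1 Q t≤L ⟩
  ∏⁻ evens Q t                                      ≡⟨ causal (∏⁻-isMultiplier evens) t (λ k k≤t → q≡∏⁺ (ℕₚ.≤-trans k≤t t≤2t)) ⟩
  ∏⁻ evens (∏⁺ (range 1 (t ℕ.+ t)) δ₀) t             ≡⟨ multipliers-commute (∏⁻-isMultiplier evens) (∏⁺-isMultiplier (range 1 (t ℕ.+ t))) δ₀ t ⟩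
  ∏⁺ (range 1 (t ℕ.+ t)) (∏⁻ evens δ₀) t             ≡⟨ gauss-triangular (t ℕ.+ t) δ₀ ℕₚ.≤-refl ⟨
  triangularSum (suc (t ℕ.+ t)) δ₀ t                ≡⟨ δt-triangularSum (s≤s t≤2t) ⟨
  δt t                                              ∎
  where
  Q : Series
  Q n = + q n
  t≤2t = ℕₚ.m≤m+n t t
  t≤L = ℕₚ.m≤n⇒m≤1+n t≤2t
  evens = map (2 ℕ.*_) (range 1 (suc (t ℕ.+ t)))

p-δt-identity : ∀ t → sumTo (t / 2) (λ k → (+ p k) * δt (t ∸ 2 ℕ.* k)) ≡ + q t
p-δt-identity t = begin
  sumTo (t / 2) (λ k → P k * δt (t ∸ 2 ℕ.* k))          ≡⟨ sumTo-∑ (t / 2) (λ k → P k * δt (t ∸ 2 ℕ.* k)) ⟩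
  ∑ (suc (t / 2)) (λ k → P k * δt (t ∸ 2 ℕ.* k))        ≡⟨ [x^]-coefficient 1 P δt t ⟨
  (P [x^ 2 ]· δt) t                                     ≡⟨ causal ([x^]-isMultiplier 1 P) t (λ k k≤t → δt-triangularSum (s≤s (ℕₚ.≤-trans k≤t t≤2t))) ⟩
  (P [x^ 2 ]· triangularSum L δ₀) t                     ≡⟨ multipliers-commute ([x^]-isMultiplier 1 P) (triangularSum-isMultiplier L) δ₀ t ⟩
  triangularSum L (P [x^ 2 ]· δ₀) t                     ≡⟨ gauss-triangular (t ℕ.+ t) (P [x^ 2 ]· δ₀) ℕₚ.≤-refl ⟩
  ∏⁺ (range 1 (t ℕ.+ t)) (∏⁻ evens (P [x^ 2 ]· δ₀)) t    ≡⟨ cong-≗ (∏⁺-isMultiplier (range 1 (t ℕ.+ t))) (∏⁻-[x^] 1 (range 1 L) P δ₀) t ⟨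
  ∏⁺ (range 1 (t ℕ.+ t)) (∏⁻ (range 1 L) P [x^ 2 ]· δ₀) t ≡⟨ causal (∏⁺-isMultiplier (range 1 (t ℕ.+ t))) t inverse ⟩
  ∏⁺ (range 1 (t ℕ.+ t)) δ₀ t                           ≡⟨ q≡∏⁺ t≤2t ⟨
  + q t                                                 ∎
  where
  P : Series
  P n = + p n
  t≤2t = ℕₚ.m≤m+n t t
  L = suc (t ℕ.+ t)
  evens = map (2 ℕ.*_) (range 1 L)
  inverse : ∏⁻ (range 1 L) P [x^ 2 ]· δ₀ ≗[≤ t ] δ₀
  inverse k k≤t = trans ([x^]-causalˡ 1 δ₀ k product-inverse) (δ₀-[x^] 1 δ₀ k)
    where
    product-inverse : ∏⁻ (range 1 L) P ≗[≤ k ] δ₀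
    product-inverse j j≤k = trans (causal (∏⁻-isMultiplier (range 1 L)) j (λ i i≤j → p≡partitionCount (below i i≤j)))
                                  (unrestricted-product L j)
      where
      below : ∀ i → i ≤ j → i ≤ L
      below i i≤j = ℕₚ.≤-trans i≤j (ℕₚ.≤-trans j≤k (ℕₚ.≤-trans k≤t (ℕₚ.m≤n⇒m≤1+n t≤2t)))

qq-δt-identity : ∀ t → sumTo t (λ k → negOnePow k * (+ qq k) * δt (t ∸ k)) ≡ (if isOdd t then + 0 else ω (t / 2))
qq-δt-identity t = begin
  sumTo t (λ k → QQ k * δt (t ∸ k))                              ≡⟨ sumTo-∑ t (λ k → QQ k * δt (t ∸ k)) ⟩
  ∑ (suc t) (λ k → QQ k * δt (t ∸ k))                            ≡⟨ [x^1]-coefficient QQ δt t ⟨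
  (QQ [x^ 1 ]· δt) t                                             ≡⟨ causal ([x^]-isMultiplier 0 QQ) t (λ k k≤t → δt-triangularSum (s≤s (ℕₚ.≤-trans k≤t t≤2t))) ⟩
  (QQ [x^ 1 ]· triangularSum L δ₀) t                             ≡⟨ multipliers-commute ([x^]-isMultiplier 0 QQ) (triangularSum-isMultiplier L) δ₀ t ⟩
  triangularSum L (QQ [x^ 1 ]· δ₀) t                             ≡⟨ cong-≗ (triangularSum-isMultiplier L) ([x^1]-δ₀ QQ) t ⟩
  triangularSum L QQ t                                           ≡⟨ gauss-triangular (t ℕ.+ t) QQ ℕₚ.≤-refl ⟩
  ∏⁺ A (∏⁻ (map (2 ℕ.*_) (range 1 L)) QQ) t                      ≡⟨ causal (∘-isMultiplier (∏⁺-isMultiplier A) (∏⁻-isMultiplier (map (2 ℕ.*_) (range 1 L)))) t QQ≡odd-product ⟩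
  ∏⁺ A (∏⁻ (map (2 ℕ.*_) (range 1 L)) (∏⁻ (odds t) δ₀)) t        ≡⟨ causal (∏⁺-isMultiplier A) t (∏⁻-evens-truncate (∏⁻ (odds t) δ₀) (ℕₚ.m≤n⇒m≤1+n t≤2t)) ⟩
  ∏⁺ A (∏⁻ (map (2 ℕ.*_) (range 1 t)) (∏⁻ (odds t) δ₀)) t        ≡⟨ cong-≗ (∏⁺-isMultiplier A) (multipliers-commute (∏⁻-isMultiplier (map (2 ℕ.*_) (range 1 t))) (∏⁻-isMultiplier (odds t)) δ₀) t ⟩
  ∏⁺ A (∏⁻ (odds t) (∏⁻ (map (2 ℕ.*_) (range 1 t)) δ₀)) t        ≡⟨ euler-odd-distinct t δ₀ t ⟩
  ∏⁻ (map (2 ℕ.*_) (range 1 (t ℕ.+ t))) δ₀ t                     ≡⟨ ω-[x^] 1 δ₀ t≤2t ⟨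
  (ω [x^ 2 ]· δ₀) t                                              ≡⟨ ω[x^2]-δ₀ t ⟩
  (if isOdd t then + 0 else ω (t / 2))                           ∎
  where
  QQ : Series
  QQ n = negOnePow n * + qq n
  t≤2t = ℕₚ.m≤m+n t t
  L = suc (t ℕ.+ t)
  A = range 1 (t ℕ.+ t)
  QQ≡odd-product : QQ ≗[≤ t ] ∏⁻ (odds t) δ₀
  QQ≡odd-product k k≤t = trans (qq≡alternate (ℕₚ.≤-trans k≤t t≤2t)) (distinctOdd-product t k)

theorem3 : (n : ℕ) →
      (sumTo (n / 2) (λ k → (+ q (n ∸ 2 Data.Nat.* k)) * ω k) ≡ δt n)
    × (sumTo (n / 2) (λ k → (+ p k) * δt (n ∸ 2 Data.Nat.* k)) ≡ + q n)
    × (sumTo n (λ k → negOnePow k * (+ qq k) * δt (n ∸ k))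
         ≡ (if isOdd n then + 0 else ω (n / 2)))
theorem3 n = q-ω-identity n , p-δt-identity n , qq-δt-identity n
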